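{- Let $q$ be an odd prime power and consider the three lines of $Q^-(5,q)$ $l=L(I,0,0)$, $m=L(0,0,I)$, $n=L(F_0,F_1,F_2)$, where $F_i(x)=f_ix+g_ix^q$ ($f_i,g_i\in\mathrm{GF}(q^2)$, $i=0,1,2$), and suppose $l,m,n$ span the whole space. Then $l,m,n$ are in perspective if and only if $f_0^qf_2+g_0g_2^q\in\mathrm{GF}(q)$.
   Context: Let $\widehat V=\{(x,x^q,y,y^q,z,z^q):x,y,z\in\mathrm{GF}(q^2)\}$, a 6-dimensional $\mathrm{GF}(q)$-space; write $(x,y,z)_2$ for its vectors. The quadratic form $\widehat Q((x,y,z)_2)=-xz^q-x^qz+y^{q+1}$ defines an elliptic quadric $Q^-(5,q)$ of $\mathrm{PG}(\widehat V)$, with associated bilinear form $\widehat{\mathbf b}(v,v')=-xz'^q-x^qz'+yy'^q+y^qy'-zx'^q-z^qx'$ and polarity $W\mapsto W^\perp$. For $\mathrm{GF}(q)$-linear maps $F_0,F_1,F_2:\mathrm{GF}(q^2)\to\mathrm{GF}(q^2)$, $L(F_0,F_1,F_2)=\{(F_0(x),F_1(x),F_2(x))_2:x\in\mathrm{GF}(q^2)\}$ (assumed 2-dimensional); $I$ is the identity map and $0$ the zero map. Lines $l$ of $Q^-(5,q)$ are 2-dimensional totally singular subspaces. Three pairwise disjoint lines $l_1,l_2,l_3$ of $Q^-(5,q)$ are in perspective if, with $T_i=l_i^\perp$, $s_k=T_i\cap T_j$, $\Sigma_k=\langle s_k,l_k\rangle$ for $\{i,j,k\}=\{1,2,3\}$,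 the intersection $\Sigma_1\cap\Sigma_2\cap\Sigma_3$ is 2-dimensional. -}

module Defs where

open import Level using (Level; _⊔_)
open import Algebra.Bundles using (CommutativeRing)
open import Data.Nat as ℕ using (ℕ; zero; suc; _%_; _^_; _≤_)
open import Data.Nat.Primality using (Prime)
open import Data.Fin using (Fin)
open import Data.Product using (Σ; ∃; ∃₂; _×_; _,_)
open import Relation.Nullary using (¬_)
open import Relation.Binary.PropositionalEquality using (_≡_)

OddPrimePower : ℕ → Set
OddPrimePower q = ∃₂ λ p k → Prime p × p % 2 ≡ 1 × 1 ≤ k × q ≡ p ^ k

module Geometry {c ℓ : Level} (R : CommutativeRing c ℓ) where
  open CommutativeRing R

  IsField : Set (c ⊔ ℓ)
  IsField = (¬ 0# ≈ 1#) × (∀ x → ¬ x ≈ 0# → ∃ λ y → x * y ≈ 1#)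

  HasSize : ℕ → Set (c ⊔ ℓ)
  HasSize n = Σ (Fin n → Carrier) λ e →
    (∀ i j → e i ≈ e j → i ≡ j) × (∀ x → ∃ λ i → e i ≈ x)

  pow : Carrier → ℕ → Carrier
  pow x zero = 1#
  pow x (suc n) = x * pow x n

  -- Everything below is relative to q, with R playing the role of GF(q²).
  module WithQ (q : ℕ) where

    conj : Carrier → Carrier
    conj x = pow x q

    InGFq : Carrier → Set ℓ
    InGFq a = conj a ≈ a

    -- (x , y , z)₂ ; the 6-dimensional GF(q)-space V̂ is identified with
    -- triples over GF(q²) (the coordinates x^q, y^q, z^q are determined)
    record V : Set c where
      constructor ⟨_,_,_⟩
      field
        vx vy vz : Carrier
    open V public

    _≈ᵥ_ : V → V → Set ℓ
    u ≈ᵥ w = (vx u ≈ vx w) × (vy u ≈ vy w) × (vz u ≈ vz w)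

    0ᵥ : V
    0ᵥ = ⟨ 0# , 0# , 0# ⟩

    _+ᵥ_ : V → V → V
    u +ᵥ w = ⟨ vx u + vx w , vy u + vy w , vz u + vz w ⟩

    _·ᵥ_ : Carrier → V → V
    a ·ᵥ u = ⟨ a * vx u , a * vy u , a * vz u ⟩

    Qf : V → Carrier
    Qf u = (- (vx u * conj (vz u)) - conj (vx u) * vz u) + pow (vy u) (suc q)

    Bf : V → V → Carrier
    Bf u w = ((((- (vx u * conj (vz w)) - conj (vx u) * vz w)
              + vy u * conj (vy w)) + conj (vy u) * vy w)
              - vz u * conj (vx w)) - conj (vz u) * vx w

    Sub : Set (Level.suc (c ⊔ ℓ))
    Sub = V → Set (c ⊔ ℓ)

    _⊥ : Sub → Sub
    (W ⊥) u = ∀ w → W w → Bf u w ≈ 0#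

    _∩_ : Sub → Sub → Sub
    (W ∩ U) u = W u × U u

    ⟨_⸴_⟩ : Sub → Sub → Sub
    ⟨ W ⸴ U ⟩ u = ∃₂ λ w w' → W w × U w' × u ≈ᵥ (w +ᵥ w')

    L : (Carrier → Carrier) → (Carrier → Carrier) → (Carrier → Carrier) → Sub
    L F₀ F₁ F₂ u = ∃ λ x → u ≈ᵥ ⟨ F₀ x , F₁ x , F₂ x ⟩

    I O : Carrier → Carrier
    I x = x
    O x = 0#

    lin : Carrier → Carrier → Carrier → Carrier
    lin f g x = f * x + g * conj x

    Dim2 : Sub → Set (c ⊔ ℓ)
    Dim2 W = ∃₂ λ u w →
      (∀ a b → InGFq a → InGFq b → ((a ·ᵥ u) +ᵥ (b ·ᵥ w)) ≈ᵥ 0ᵥ → (a ≈ 0#) × (b ≈ 0#))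
      × (∀ a b → InGFq a → InGFq b → W ((a ·ᵥ u) +ᵥ (b ·ᵥ w)))
      × (∀ v → W v → ∃₂ λ a b → InGFq a × InGFq b × v ≈ᵥ ((a ·ᵥ u) +ᵥ (b ·ᵥ w)))

    TotallySingular : Sub → Set (c ⊔ ℓ)
    TotallySingular W = ∀ u → W u → Qf u ≈ 0#

    IsLine : Sub → Set (c ⊔ ℓ)
    IsLine W = TotallySingular W × Dim2 W

    SpanAll : Sub → Sub → Sub → Set (c ⊔ ℓ)
    SpanAll W₁ W₂ W₃ = ∀ u → ∃₂ λ a b → ∃ λ d →
      W₁ a × W₂ b × W₃ d × u ≈ᵥ ((a +ᵥ b) +ᵥ d)

    InPerspective : Sub → Sub → Sub → Set (c ⊔ ℓ)
    InPerspective l₁ l₂ l₃ = Dim2 ((Σ₁ ∩ Σ₂) ∩ Σ₃)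
      where
        Σ₁ Σ₂ Σ₃ : Sub
        Σ₁ = ⟨ (l₂ ⊥) ∩ (l₃ ⊥) ⸴ l₁ ⟩
        Σ₂ = ⟨ (l₁ ⊥) ∩ (l₃ ⊥) ⸴ l₂ ⟩
        Σ₃ = ⟨ (l₁ ⊥) ∩ (l₂ ⊥) ⸴ l₃ ⟩

-- Write x̄ = x ^ q, τ a b = a b̄ + ā b and F t = (F₀ t , F₁ t , F₂ t) for the
-- points of n; then b̂ = τ(y,y') − τ(x,z') − τ(z,x'), l^⊥ = {z = 0} and
-- m^⊥ = {x = 0}. Hence a vector of Σ₁ ∩ Σ₂ ∩ Σ₃ is (F₀ t , y , F₂ t) with
-- (0 , y , F₂ t) and (F₀ t , y , 0) orthogonal to n. As n is totally isotropic
-- and F₁ is onto, the sum and difference of these two conditions say that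
-- 2 y = F₁ t and that D t s = τ(F₀ t, F₂ s) − τ(F₂ t, F₀ s) vanishes for all s;
-- and D t s = (γ − γ̄)(t̄ s − t s̄) with γ = f̄₀ f₂ + g₀ ḡ₂. So if γ ∈ GF(q) the
-- intersection is the image of the injective GF(q)-linear map
-- t ↦ (F₀ t , F₁ t / 2 , F₂ t), a plane, and otherwise it is zero.
-- The field theory needed is that x ↦ x ^ q is an involutive automorphism of the
-- field with q² elements (Frobenius and Fermat), that its fixed field GF(q) is
-- proper, and that 2 is invertible.

module Submission where

open import Defs
open import Level using (Level)
open import Algebra.Bundles using (CommutativeRing; CommutativeMonoid; RawRing)
open import Data.Nat as ℕ using (ℕ; zero; suc; _!; _<_) renaming (_*_ to _*ℕ_)
import Data.Nat.Properties as ℕ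
open import Data.Nat.Combinatorics using (_C_; nCk≡n!/k![n-k]!; k![n∸k]!∣n!; nCn≡1)
open import Data.Nat.DivMod using (m/n*n≡m; _/_; _%_; m≡m%n+[m/n]*n)
open import Data.Nat.Divisibility using (_∣_; divides; ∣1⇒≡1; ∣⇒≤; m∣m*n)
open import Data.Nat.Primality using (Prime; euclidsLemma; prime⇒nonTrivial)
open import Data.Fin as Fin using (Fin; inject₁; fromℕ; punchIn)
import Data.Fin.Properties as Fin
open import Data.Fin.Permutation using (permutation)
open import Data.Maybe using (Maybe; just; nothing)
import Data.Product as Product
open import Data.Product.Properties using (≡-dec)
open import Data.Product using (∃; ∃₂; _,_; proj₁; proj₂)
open import Data.Sum using (_⊎_; inj₁; inj₂)
open import Data.Empty using (⊥-elim)
open import Function.Bundles using (_⇔_; mk⇔)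
open import Relation.Nullary using (¬_; yes; no)
open import Relation.Binary.Definitions using (Decidable)
open import Relation.Binary.PropositionalEquality as ≡ using (_≡_; _≢_)
import Algebra.Properties.CommutativeMonoid.Sum as CommutativeMonoidSum
import Algebra.Properties.CommutativeSemigroup as CommutativeSemigroupProperties
import Algebra.Properties.CommutativeSemiring.Binomial as Binomial
import Algebra.Properties.CommutativeSemiring.Exp as CommutativeSemiringExp
import Algebra.Properties.Ring as RingProperties
import Algebra.Properties.Semiring.Mult as SemiringMult
import Algebra.Solver.Ring as RingSolver
import Algebra.Solver.Ring.AlmostCommutativeRing as ACR
import Relation.Binary.Reasoning.Setoid as SetoidReasoning

-- The stock solver needs a coefficient ring whose equality it can decide
-- syntactically; integers are encoded as pairs (a , b) meaning a − b,
-- normalised so that one component is zero.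
module IntegerSolver {c ℓ : Level} (R : CommutativeRing c ℓ) where
  open Product using (_×_)
  open CommutativeRing R
  open RingProperties ring using (-‿distribˡ-*; -‿distribʳ-*; -‿involutive; -‿+-comm; -0#≈0#)
  open CommutativeSemigroupProperties +-commutativeSemigroup using (interchange)
  open SemiringMult semiring using (×1-homo-*; ×-homo-+) renaming (_×_ to _·_)
  open SetoidReasoning setoid

  ℤ² : Set
  ℤ² = ℕ × ℕ

  normalise : ℕ → ℕ → ℤ²
  normalise (suc a) (suc b) = normalise a b
  normalise a b = a , b

  integers : RawRing _ _
  integers = record
    { Carrier = ℤ²
    ; _≈_ = _≡_
    ; _+_ = λ { (a , b) (a' , b') → normalise (a ℕ.+ a') (b ℕ.+ b') }
    ; _*_ = λ { (a , b) (a' , b') →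
                normalise (a ℕ.* a' ℕ.+ b ℕ.* b') (a ℕ.* b' ℕ.+ b ℕ.* a') }
    ; -_ = λ { (a , b) → b , a }
    ; 0# = 0 , 0
    ; 1# = 1 , 0
    }

  ⟦_⟧ℤ : ℤ² → Carrier
  ⟦ a , b ⟧ℤ = a · 1# - b · 1#

  -+-distrib : ∀ x y u v → (x - y) + (u - v) ≈ (x + u) - (y + v)
  -+-distrib x y u v = trans (interchange x (- y) u (- v)) (+-congˡ (-‿+-comm y v))

  -*-distrib : ∀ x y u v → (x - y) * (u - v) ≈ (x * u + y * v) - (x * v + y * u)
  -*-distrib x y u v = begin
    (x - y) * (u - v)                         ≈⟨ distribʳ (u - v) x (- y) ⟩
    x * (u - v) + - y * (u - v)               ≈⟨ +-cong (distribˡ x u (- v)) (distribˡ (- y) u (- v)) ⟩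
    (x * u + x * - v) + (- y * u + - y * - v) ≈⟨ +-cong (+-congˡ (sym (-‿distribʳ-* x v)))
                                                        (+-cong (sym (-‿distribˡ-* y u)) -y*-v≈y*v) ⟩
    (x * u - x * v) + (- (y * u) + y * v)     ≈⟨ +-congˡ (+-comm _ _) ⟩
    (x * u - x * v) + (y * v - y * u)         ≈⟨ -+-distrib _ _ _ _ ⟩
    (x * u + y * v) - (x * v + y * u)         ∎
    where
    -y*-v≈y*v : - y * - v ≈ y * v
    -y*-v≈y*v = begin
      - y * - v     ≈⟨ sym (-‿distribˡ-* y (- v)) ⟩
      - (y * - v)   ≈⟨ -‿cong (sym (-‿distribʳ-* y v)) ⟩
      - - (y * v)   ≈⟨ -‿involutive _ ⟩
      y * v         ∎

  ⟦normalise⟧ : ∀ a b → ⟦ normalise a b ⟧ℤ ≈ a · 1# - b · 1#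
  ⟦normalise⟧ zero b = refl
  ⟦normalise⟧ (suc a) zero = refl
  ⟦normalise⟧ (suc a) (suc b) = begin
    ⟦ normalise a b ⟧ℤ                  ≈⟨ ⟦normalise⟧ a b ⟩
    a · 1# - b · 1#                     ≈⟨ +-congˡ (sym (+-identityˡ _)) ⟩
    a · 1# + (0# - b · 1#)              ≈⟨ +-congˡ (+-congʳ (sym (-‿inverseʳ 1#))) ⟩
    a · 1# + ((1# - 1#) - b · 1#)       ≈⟨ +-congˡ (+-assoc _ _ _) ⟩
    a · 1# + (1# + (- 1# - b · 1#))     ≈⟨ sym (+-assoc _ _ _) ⟩
    (a · 1# + 1#) + (- 1# - b · 1#)     ≈⟨ +-cong (+-comm _ _) (-‿+-comm 1# (b · 1#)) ⟩
    (1# + a · 1#) - (1# + b · 1#)       ∎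

  ⟦⟧-homomorphism : integers ACR.-Raw-AlmostCommutative⟶ ACR.fromCommutativeRing R
  ⟦⟧-homomorphism = record
    { ⟦_⟧ = ⟦_⟧ℤ
    ; +-homo = λ { (a , b) (a' , b') → trans (⟦normalise⟧ (a ℕ.+ a') (b ℕ.+ b'))
        (trans (+-cong (×-homo-+ 1# a a') (-‿cong (×-homo-+ 1# b b'))) (sym (-+-distrib _ _ _ _))) }
    ; *-homo = λ { (a , b) (a' , b') → trans (⟦normalise⟧ (a ℕ.* a' ℕ.+ b ℕ.* b') (a ℕ.* b' ℕ.+ b ℕ.* a'))
        (trans (+-cong (trans (×-homo-+ 1# (a ℕ.* a') (b ℕ.* b')) (+-cong (×1-homo-* a a') (×1-homo-* b b')))
                       (-‿cong (trans (×-homo-+ 1# (a ℕ.* b') (b ℕ.* a')) (+-cong (×1-homo-* a b') (×1-homo-* b a')))))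
               (sym (-*-distrib _ _ _ _))) }
    ; -‿homo = λ { (a , b) → trans (+-congʳ (sym (-‿involutive (b · 1#)))) (trans (+-comm _ _) (-‿+-comm _ _)) }
    ; 0-homo = trans (+-identityˡ _) -0#≈0#
    ; 1-homo = trans (+-congˡ -0#≈0#) (trans (+-identityʳ _) (+-identityʳ _))
    }

  _≟ℤ_ : ∀ x y → Maybe (⟦ x ⟧ℤ ≈ ⟦ y ⟧ℤ)
  x ≟ℤ y with ≡-dec ℕ._≟_ ℕ._≟_ x y
  ... | yes ≡.refl = just refl
  ... | no _ = nothing

  open RingSolver integers (ACR.fromCommutativeRing R) ⟦⟧-homomorphism _≟ℤ_ public
    using (solve; _:=_; _:+_; _:*_; :-_; _:-_)

¬p∣m! : ∀ {p} → Prime p → ∀ m → m < p → ¬ p ∣ m !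
¬p∣m! pr zero m<p p∣1 with ∣1⇒≡1 p∣1
... | ≡.refl = ℕ.<-irrefl ≡.refl (ℕ.nonTrivial⇒n>1 _ {{prime⇒nonTrivial pr}})
¬p∣m! pr (suc m) m<p p∣m! with euclidsLemma (suc m) (m !) pr p∣m!
... | inj₁ p∣1+m = ℕ.<-irrefl ≡.refl (ℕ.≤-<-trans (∣⇒≤ p∣1+m) m<p)
... | inj₂ p∣m = ¬p∣m! pr m (ℕ.<-trans (ℕ.n<1+n m) m<p) p∣m

-- p C k * (k ! * (p ∸ k) !) ≡ p !, and p divides neither factorial on the left.
p∣pCk : ∀ {p} → Prime p → ∀ k → 0 < k → k < p → p ∣ p C k
p∣pCk {p@(suc p-1)} pr k 0<k k<p with euclidsLemma (p C k) (k ! ℕ.* (p ℕ.∸ k) !) pr p∣pCk*k![p∸k]!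
  where
  instance _ = k ℕ.!* p ℕ.∸ k !≢0
  p∣pCk*k![p∸k]! : p ∣ (p C k) ℕ.* (k ! ℕ.* (p ℕ.∸ k) !)
  p∣pCk*k![p∸k]! = ≡.subst (p ∣_)
    (≡.sym (≡.trans (≡.cong (ℕ._* (k ! ℕ.* (p ℕ.∸ k) !)) (nCk≡n!/k![n-k]! {p} {k} (ℕ.<⇒≤ k<p)))
                    (m/n*n≡m (k![n∸k]!∣n! {p} {k} (ℕ.<⇒≤ k<p)))))
    (m∣m*n (p-1 !))
... | inj₁ p∣pCk = p∣pCk
... | inj₂ p∣k![p∸k]! with euclidsLemma (k !) ((p ℕ.∸ k) !) pr p∣k![p∸k]!
...   | inj₁ p∣k! = ⊥-elim (¬p∣m! pr k k<p p∣k!)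
...   | inj₂ p∣[p∸k]! = ⊥-elim (¬p∣m! pr (p ℕ.∸ k) (ℕ.∸-monoʳ-< 0<k (ℕ.<⇒≤ k<p)) p∣[p∸k]!)

module _ {c ℓ : Level} (M : CommutativeMonoid c ℓ) where
  open CommutativeMonoid M
  open CommutativeMonoidSum M using (sum; sum-cong-≋; sum-permute)

  sum-reindex : ∀ {n} (e : Fin n → Carrier) →
    (∀ i j → e i ≈ e j → i ≡ j) → (∀ x → ∃ λ i → e i ≈ x) →
    (h h⁻¹ : Carrier → Carrier) →
    (∀ {x y} → x ≈ y → h x ≈ h y) → (∀ {x y} → x ≈ y → h⁻¹ x ≈ h⁻¹ y) →
    (∀ x → h (h⁻¹ x) ≈ x) → (∀ x → h⁻¹ (h x) ≈ x) →
    (G : Carrier → Carrier) → (∀ {x y} → x ≈ y → G x ≈ G y) →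
    sum (λ i → G (h (e i))) ≈ sum (λ i → G (e i))
  sum-reindex e inj sur h h⁻¹ h-cong h⁻¹-cong h∘h⁻¹ h⁻¹∘h G G-cong =
    trans (sum-cong-≋ (λ i → G-cong (sym (proj₂ (sur (h (e i)))))))
          (sym (sum-permute (λ i → G (e i)) (permutation π π⁻¹ π∘π⁻¹ π⁻¹∘π)))
    where
    π π⁻¹ : _ → _
    π i = proj₁ (sur (h (e i)))
    π⁻¹ i = proj₁ (sur (h⁻¹ (e i)))
    π∘π⁻¹ : ∀ i → π (π⁻¹ i) ≡ i
    π∘π⁻¹ i = inj _ _ (trans (proj₂ (sur _)) (trans (h-cong (proj₂ (sur _))) (h∘h⁻¹ (e i))))
    π⁻¹∘π : ∀ i → π⁻¹ (π i) ≡ i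
    π⁻¹∘π i = inj _ _ (trans (proj₂ (sur _)) (trans (h⁻¹-cong (proj₂ (sur _))) (h⁻¹∘h (e i))))

module FiniteField {c ℓ : Level} (R : CommutativeRing c ℓ) (isField : Geometry.IsField R)
                   {N : ℕ} (size : Geometry.HasSize R N) where
  open CommutativeRing R
  open Geometry R using (pow)
  open SetoidReasoning setoid
  open RingProperties ring using (+-identityʳ-unique)
  open SemiringMult semiring using (_×_; ×1-homo-*; ×-assoc-*; ×-congʳ; ×-homo-+)
  open CommutativeSemiringExp commutativeSemiring public using (_^_; ^-congˡ; ^-assocʳ; ^-distrib-*)
  open CommutativeMonoidSum +-commutativeMonoid using (sum; ∑-distrib-+; sum-replicate; sum-init-last; sum-cong-≋; sum-replicate-zero)
  open CommutativeMonoidSum *-commutativeMonoid using () renaming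
    (sum to ∏; sum-remove to ∏-remove; sum-replicate to ∏-replicate; sum-cong-≋ to ∏-cong-≋)

  element : Fin N → Carrier
  element = proj₁ size

  element-injective : ∀ i j → element i ≈ element j → i ≡ j
  element-injective = proj₁ (proj₂ size)

  element-surjective : ∀ x → ∃ λ i → element i ≈ x
  element-surjective = proj₂ (proj₂ size)

  infix 4 _≟_
  _≟_ : Decidable _≈_
  x ≟ y with element-surjective x | element-surjective y
  ... | i , eᵢ≈x | j , eⱼ≈y with i Fin.≟ j
  ...   | yes ≡.refl = yes (trans (sym eᵢ≈x) eⱼ≈y)
  ...   | no i≢j = no λ x≈y → i≢j (element-injective i j (trans eᵢ≈x (trans x≈y (sym eⱼ≈y))))

  1≉0 : ¬ 1# ≈ 0#
  1≉0 1≈0 = proj₁ isField (sym 1≈0)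

  ∃-inverse : ∀ x → ¬ x ≈ 0# → ∃ λ y → x * y ≈ 1#
  ∃-inverse = proj₂ isField

  *-cancelˡ : ∀ {x y z} → ¬ x ≈ 0# → x * y ≈ x * z → y ≈ z
  *-cancelˡ {x} {y} {z} x≉0 xy≈xz with ∃-inverse x x≉0
  ... | x⁻¹ , xx⁻¹≈1 = begin
    y                ≈⟨ sym (*-identityˡ y) ⟩
    1# * y           ≈⟨ *-congʳ (sym x⁻¹x≈1) ⟩
    (x⁻¹ * x) * y    ≈⟨ *-assoc _ _ _ ⟩
    x⁻¹ * (x * y)    ≈⟨ *-congˡ xy≈xz ⟩
    x⁻¹ * (x * z)    ≈⟨ sym (*-assoc _ _ _) ⟩
    (x⁻¹ * x) * z    ≈⟨ *-congʳ x⁻¹x≈1 ⟩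
    1# * z           ≈⟨ *-identityˡ z ⟩
    z                ∎
    where x⁻¹x≈1 = trans (*-comm x⁻¹ x) xx⁻¹≈1

  x*y≈0⇒x≈0⊎y≈0 : ∀ {x y} → x * y ≈ 0# → x ≈ 0# ⊎ y ≈ 0#
  x*y≈0⇒x≈0⊎y≈0 {x} {y} xy≈0 with x ≟ 0#
  ... | yes x≈0 = inj₁ x≈0
  ... | no x≉0 = inj₂ (*-cancelˡ x≉0 (trans xy≈0 (sym (zeroʳ x))))

  x≉0∧y≉0⇒x*y≉0 : ∀ {x y} → ¬ x ≈ 0# → ¬ y ≈ 0# → ¬ x * y ≈ 0#
  x≉0∧y≉0⇒x*y≉0 x≉0 y≉0 xy≈0 with x*y≈0⇒x≈0⊎y≈0 xy≈0
  ... | inj₁ x≈0 = x≉0 x≈0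
  ... | inj₂ y≈0 = y≉0 y≈0

  x^n≈0⇒x≈0 : ∀ {x} n → x ^ n ≈ 0# → x ≈ 0#
  x^n≈0⇒x≈0 zero 1≈0 = ⊥-elim (1≉0 1≈0)
  x^n≈0⇒x≈0 (suc n) xxⁿ≈0 with x*y≈0⇒x≈0⊎y≈0 xxⁿ≈0
  ... | inj₁ x≈0 = x≈0
  ... | inj₂ xⁿ≈0 = x^n≈0⇒x≈0 n xⁿ≈0

  pow≈^ : ∀ x n → pow x n ≈ x ^ n
  pow≈^ x zero = refl
  pow≈^ x (suc n) = *-congˡ (pow≈^ x n)

  -- Translation by 1 permutes the field, so adding N copies of 1 to the sum of
  -- all elements changes nothing.
  N×1≈0 : N × 1# ≈ 0#
  N×1≈0 = +-identityʳ-unique (sum element) (N × 1#) (begin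
    sum element + N × 1#          ≈⟨ sym (trans (∑-distrib-+ element (λ _ → 1#)) (+-congˡ (sum-replicate N))) ⟩
    sum (λ i → element i + 1#)
      ≈⟨ sum-reindex +-commutativeMonoid element element-injective element-surjective (_+ 1#) (_- 1#) +-congʳ +-congʳ
           (λ x → trans (+-assoc _ _ _) (trans (+-congˡ (-‿inverseˡ 1#)) (+-identityʳ x)))
           (λ x → trans (+-assoc _ _ _) (trans (+-congˡ (-‿inverseʳ 1#)) (+-identityʳ x)))
           (λ x → x) (λ x≈y → x≈y) ⟩
    sum element                   ∎)

  prime-characteristic : ∀ {p k} → Prime p → N ≡ p ℕ.^ k → p × 1# ≈ 0#
  prime-characteristic {p} {k} _ N≡pᵏ = x^n≈0⇒x≈0 k (begin
    (p × 1#) ^ k   ≈⟨ sym (pᵏ×1≈[p×1]ᵏ k) ⟩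
    (p ℕ.^ k) × 1# ≈⟨ reflexive (≡.cong (_× 1#) (≡.sym N≡pᵏ)) ⟩
    N × 1#         ≈⟨ N×1≈0 ⟩
    0#             ∎)
    where
    pᵏ×1≈[p×1]ᵏ : ∀ k → (p ℕ.^ k) × 1# ≈ (p × 1#) ^ k
    pᵏ×1≈[p×1]ᵏ zero = +-identityʳ 1#
    pᵏ×1≈[p×1]ᵏ (suc k) = trans (×1-homo-* p (p ℕ.^ k)) (*-congˡ (pᵏ×1≈[p×1]ᵏ k))

  private
    unit : Carrier → Carrier
    unit x with x ≟ 0#
    ... | yes _ = 1#
    ... | no _ = x

    unit-cong : ∀ {x y} → x ≈ y → unit x ≈ unit y
    unit-cong {x} {y} x≈y with x ≟ 0# | y ≟ 0#
    ... | yes _ | yes _ = refl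
    ... | yes x≈0 | no y≉0 = ⊥-elim (y≉0 (trans (sym x≈y) x≈0))
    ... | no x≉0 | yes y≈0 = ⊥-elim (x≉0 (trans x≈y y≈0))
    ... | no _ | no _ = x≈y

    unit≉0 : ∀ x → ¬ unit x ≈ 0#
    unit≉0 x with x ≟ 0#
    ... | yes _ = 1≉0
    ... | no x≉0 = x≉0

    scale : Carrier → Carrier → Carrier
    scale a x with x ≟ 0#
    ... | yes _ = 1#
    ... | no _ = a

    unit-* : ∀ a x → ¬ a ≈ 0# → unit (a * x) ≈ scale a x * unit x
    unit-* a x a≉0 with x ≟ 0# | a * x ≟ 0#
    ... | yes _ | yes _ = sym (*-identityˡ 1#)
    ... | yes x≈0 | no ax≉0 = ⊥-elim (ax≉0 (trans (*-congˡ x≈0) (zeroʳ a)))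
    ... | no x≉0 | yes ax≈0 = ⊥-elim (x≉0∧y≉0⇒x*y≉0 a≉0 x≉0 ax≈0)
    ... | no _ | no _ = refl

  ∏≉0 : ∀ {n} (t : Fin n → Carrier) → (∀ i → ¬ t i ≈ 0#) → ¬ ∏ t ≈ 0#
  ∏≉0 {zero} t _ = 1≉0
  ∏≉0 {suc n} t t≉0 = x≉0∧y≉0⇒x*y≉0 (t≉0 Fin.zero) (∏≉0 (λ i → t (Fin.suc i)) (λ i → t≉0 (Fin.suc i)))

  a*∏≈a^n : ∀ {n} a (t : Fin n → Carrier) i₀ → t i₀ ≈ 1# → (∀ i → i ≢ i₀ → t i ≈ a) →
    a * ∏ t ≈ a ^ n
  a*∏≈a^n {suc n} a t i₀ tᵢ₀≈1 tᵢ≈a = begin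
    a * ∏ t                                   ≈⟨ *-congˡ (∏-remove {i = i₀} t) ⟩
    a * (t i₀ * ∏ (λ j → t (punchIn i₀ j)))   ≈⟨ *-congˡ (*-cong tᵢ₀≈1 (∏-cong-≋ {n} {λ j → t (punchIn i₀ j)} {λ _ → a} λ j → tᵢ≈a _ (Fin.punchInᵢ≢i i₀ j))) ⟩
    a * (1# * ∏ {n} (λ _ → a))                ≈⟨ *-congˡ (trans (*-identityˡ (∏ {n} (λ _ → a))) (∏-replicate n)) ⟩
    a ^ suc n                                 ∎

  -- Fermat: multiplication by a ≉ 0 permutes the field; comparing the products
  -- of all elements (0 counted as 1) before and after gives a ^ (N - 1) ≈ 1.
  x^N≈x : ∀ x → x ^ N ≈ x
  x^N≈x a with a ≟ 0# | element-surjective 0#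
  ... | yes a≈0 | i₀ , _ = trans (^-congˡ N a≈0) (trans (0^N≈0 i₀) (sym a≈0))
    where
    0^N≈0 : ∀ {n} → Fin n → 0# ^ n ≈ 0#
    0^N≈0 {suc n} _ = zeroˡ _
  ... | no a≉0 | i₀ , elementᵢ₀≈0 = *-cancelˡ (∏≉0 _ (λ i → unit≉0 (element i)))
    (trans (*-comm _ _) (trans (*-congʳ (sym a*∏scale≈a^N)) (trans (*-assoc _ _ _)
      (trans (*-congˡ ∏scale*P≈P) (*-comm _ _)))))
    where
    a⁻¹ = proj₁ (∃-inverse a a≉0)
    aa⁻¹≈1 = proj₂ (∃-inverse a a≉0)
    P = ∏ (λ i → unit (element i))
    ∏scale*P≈P : ∏ (λ i → scale a (element i)) * P ≈ P
    ∏scale*P≈P = begin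
      ∏ (λ i → scale a (element i)) * P                ≈⟨ sym (CommutativeMonoidSum.∑-distrib-+ *-commutativeMonoid (λ i → scale a (element i)) (λ i → unit (element i))) ⟩
      ∏ (λ i → scale a (element i) * unit (element i))        ≈⟨ ∏-cong-≋ (λ i → sym (unit-* a (element i) a≉0)) ⟩
      ∏ (λ i → unit (a * element i))
        ≈⟨ sum-reindex *-commutativeMonoid element element-injective element-surjective (a *_) (a⁻¹ *_) *-congˡ *-congˡ
             (λ x → trans (sym (*-assoc _ _ _)) (trans (*-congʳ aa⁻¹≈1) (*-identityˡ x)))
             (λ x → trans (sym (*-assoc _ _ _)) (trans (*-congʳ (trans (*-comm _ _) aa⁻¹≈1)) (*-identityˡ x)))
             unit unit-cong ⟩
      P                                           ∎
    scaleᵢ₀≈1 : scale a (element i₀) ≈ 1#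
    scaleᵢ₀≈1 with element i₀ ≟ 0#
    ... | yes _ = refl
    ... | no eᵢ₀≉0 = ⊥-elim (eᵢ₀≉0 elementᵢ₀≈0)
    scaleᵢ≈a : ∀ i → i ≢ i₀ → scale a (element i) ≈ a
    scaleᵢ≈a i i≢i₀ with element i ≟ 0#
    ... | yes eᵢ≈0 = ⊥-elim (i≢i₀ (element-injective i i₀ (trans eᵢ≈0 (sym elementᵢ₀≈0))))
    ... | no _ = refl
    a*∏scale≈a^N : a * ∏ (λ i → scale a (element i)) ≈ a ^ N
    a*∏scale≈a^N = a*∏≈a^n a _ i₀ scaleᵢ₀≈1 scaleᵢ≈a

  odd-characteristic⇒2≉0 : ∀ {p} → p % 2 ≡ 1 → p × 1# ≈ 0# → ¬ 1# + 1# ≈ 0#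
  odd-characteristic⇒2≉0 {p} p-odd p×1≈0 2≈0 = 1≉0 (begin
    1#                            ≈⟨ sym (+-identityʳ 1#) ⟩
    1# + 0#                       ≈⟨ +-congˡ (sym (trans (*-congˡ 2×1≈0) (zeroʳ _))) ⟩
    1# + (p / 2) × 1# * (2 × 1#)  ≈⟨ sym (+-cong (+-identityʳ 1#) (×1-homo-* (p / 2) 2)) ⟩
    1 × 1# + (p / 2 ℕ.* 2) × 1#    ≈⟨ sym (×-homo-+ 1# 1 (p / 2 ℕ.* 2)) ⟩
    (1 ℕ.+ p / 2 ℕ.* 2) × 1#       ≈⟨ reflexive (≡.cong (_× 1#) p≡1+[p/2]*2) ⟨
    p × 1#                        ≈⟨ p×1≈0 ⟩
    0#                            ∎)
    where
    2×1≈0 : 2 × 1# ≈ 0#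
    2×1≈0 = trans (+-congˡ (+-identityʳ 1#)) 2≈0
    p≡1+[p/2]*2 : p ≡ 1 ℕ.+ p / 2 ℕ.* 2
    p≡1+[p/2]*2 = ≡.trans (m≡m%n+[m/n]*n p 2) (≡.cong (ℕ._+ p / 2 ℕ.* 2) p-odd)

  pCk×x≈0 : ∀ {p} → Prime p → p × 1# ≈ 0# → ∀ k x → 0 < k → k < p → (p C k) × x ≈ 0#
  pCk×x≈0 {p} p-prime p×1≈0 k x 0<k k<p with p∣pCk p-prime k 0<k k<p
  ... | divides m pCk≡m*p = begin
    (p C k) × x                 ≈⟨ reflexive (≡.cong (_× x) pCk≡m*p) ⟩
    (m ℕ.* p) × x               ≈⟨ ×-congʳ (m ℕ.* p) (sym (*-identityˡ x)) ⟩
    (m ℕ.* p) × (1# * x)        ≈⟨ sym (×-assoc-* (m ℕ.* p) 1# x) ⟩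
    ((m ℕ.* p) × 1#) * x        ≈⟨ *-congʳ (×1-homo-* m p) ⟩
    ((m × 1#) * (p × 1#)) * x   ≈⟨ *-congʳ (trans (*-congˡ p×1≈0) (zeroʳ _)) ⟩
    0# * x                      ≈⟨ zeroˡ x ⟩
    0#                          ∎

  frobenius : ∀ {p} → Prime p → p × 1# ≈ 0# → ∀ x y → (x + y) ^ p ≈ x ^ p + y ^ p
  frobenius {suc m} p-prime p×1≈0 x y = begin
    (x + y) ^ suc m                               ≈⟨ theorem (suc m) x y ⟩
    term Fin.zero + sum (λ i → term (Fin.suc i))  ≈⟨ +-congˡ (sum-init-last (λ i → term (Fin.suc i))) ⟩
    term Fin.zero + (sum (λ i → term (Fin.suc (inject₁ i))) + term (Fin.suc (fromℕ m)))
      ≈⟨ +-cong (trans (+-identityʳ _) (*-identityˡ _))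
                (+-cong (trans (sum-cong-≋ middle) (sum-replicate-zero m))
                        (top (≡.cong suc (Fin.toℕ-fromℕ m)))) ⟩
    y ^ suc m + (0# + x ^ suc m)                  ≈⟨ trans (+-congˡ (+-identityˡ _)) (+-comm _ _) ⟩
    x ^ suc m + y ^ suc m                         ∎
    where
    open Binomial commutativeSemiring using (theorem; binomialTerm)
    term = binomialTerm x y (suc m)
    middle : ∀ i → term (Fin.suc (inject₁ i)) ≈ 0#
    middle i = pCk×x≈0 p-prime p×1≈0 _ _ ℕ.z<s
      (ℕ.s≤s (≡.subst (ℕ._< m) (≡.sym (Fin.toℕ-inject₁ i)) (Fin.toℕ<n i)))
    top : ∀ {j} → j ≡ suc m → (suc m C j) × (x ^ j * y ^ (suc m ℕ.∸ j)) ≈ x ^ suc m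
    top ≡.refl = begin
      (suc m C suc m) × (x ^ suc m * y ^ (m ℕ.∸ m)) ≈⟨ reflexive (≡.cong (_× (x ^ suc m * y ^ (m ℕ.∸ m))) (nCn≡1 (suc m))) ⟩
      1 × (x ^ suc m * y ^ (m ℕ.∸ m))               ≈⟨ +-identityʳ _ ⟩
      x ^ suc m * y ^ (m ℕ.∸ m)                     ≈⟨ *-congˡ (reflexive (≡.cong (y ^_) (ℕ.n∸n≡0 m))) ⟩
      x ^ suc m * 1#                                ≈⟨ *-identityʳ _ ⟩
      x ^ suc m                                     ∎

  frobenius-iterate : ∀ {p} → Prime p → p × 1# ≈ 0# → ∀ k x y → (x + y) ^ (p ℕ.^ k) ≈ x ^ (p ℕ.^ k) + y ^ (p ℕ.^ k)
  frobenius-iterate p-prime p×1≈0 zero x y = trans (*-identityʳ _) (sym (+-cong (*-identityʳ x) (*-identityʳ y)))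
  frobenius-iterate {p} p-prime p×1≈0 (suc k) x y = begin
    (x + y) ^ (p ℕ.* p ℕ.^ k)               ≈⟨ sym (^-assocʳ (x + y) p (p ℕ.^ k)) ⟩
    ((x + y) ^ p) ^ (p ℕ.^ k)               ≈⟨ ^-congˡ (p ℕ.^ k) (frobenius p-prime p×1≈0 x y) ⟩
    (x ^ p + y ^ p) ^ (p ℕ.^ k)             ≈⟨ frobenius-iterate p-prime p×1≈0 k _ _ ⟩
    (x ^ p) ^ (p ℕ.^ k) + (y ^ p) ^ (p ℕ.^ k) ≈⟨ +-cong (^-assocʳ x p _) (^-assocʳ y p _) ⟩
    x ^ (p ℕ.* p ℕ.^ k) + y ^ (p ℕ.* p ℕ.^ k) ∎

module Conjugation {c ℓ : Level} (R : CommutativeRing c ℓ) (q : ℕ) (q-odd : OddPrimePower q)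
                   (isField : Geometry.IsField R) (size : Geometry.HasSize R (q *ℕ q)) where
  open Product using (_×_)
  open CommutativeRing R
  open Geometry R
  open WithQ q
  open FiniteField R isField size public
  open SetoidReasoning setoid
  open RingProperties ring using (x+x≈x⇒x≈0; +-inverseʳ-unique)
  private module Mult = SemiringMult semiring
  open IntegerSolver R using (solve; _:=_; _:+_; _:*_; :-_; _:-_)

  private
    p = proj₁ q-odd
    k = proj₁ (proj₂ q-odd)
    p-prime = proj₁ (proj₂ (proj₂ q-odd))
    p-odd = proj₁ (proj₂ (proj₂ (proj₂ q-odd)))
    q≡pᵏ = proj₂ (proj₂ (proj₂ (proj₂ (proj₂ q-odd))))

    p×1≈0 : p Mult.× 1# ≈ 0#
    p×1≈0 = prime-characteristic {k = k ℕ.+ k} p-prime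
      (≡.trans (≡.cong₂ _*ℕ_ q≡pᵏ q≡pᵏ) (≡.sym (ℕ.^-distribˡ-+-* p k k)))

  conj≈^q : ∀ x → conj x ≈ x ^ q
  conj≈^q x = pow≈^ x q

  conj-cong : ∀ {x y} → x ≈ y → conj x ≈ conj y
  conj-cong {x} {y} x≈y = trans (conj≈^q x) (trans (^-congˡ q x≈y) (sym (conj≈^q y)))

  conj-+ : ∀ x y → conj (x + y) ≈ conj x + conj y
  conj-+ x y = begin
    conj (x + y)          ≈⟨ conj≈^q (x + y) ⟩
    (x + y) ^ q           ≈⟨ reflexive (≡.cong ((x + y) ^_) q≡pᵏ) ⟩
    (x + y) ^ (p ℕ.^ k)   ≈⟨ frobenius-iterate p-prime p×1≈0 k x y ⟩
    x ^ (p ℕ.^ k) + y ^ (p ℕ.^ k) ≈⟨ reflexive (≡.cong₂ (λ m n → x ^ m + y ^ n) (≡.sym q≡pᵏ) (≡.sym q≡pᵏ)) ⟩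
    x ^ q + y ^ q         ≈⟨ sym (+-cong (conj≈^q x) (conj≈^q y)) ⟩
    conj x + conj y       ∎

  conj-* : ∀ x y → conj (x * y) ≈ conj x * conj y
  conj-* x y = trans (conj≈^q (x * y)) (trans (^-distrib-* x y q) (sym (*-cong (conj≈^q x) (conj≈^q y))))

  conj-involutive : ∀ x → conj (conj x) ≈ x
  conj-involutive x = begin
    conj (conj x)   ≈⟨ trans (conj≈^q (conj x)) (^-congˡ q (conj≈^q x)) ⟩
    (x ^ q) ^ q     ≈⟨ ^-assocʳ x q q ⟩
    x ^ (q *ℕ q)    ≈⟨ x^N≈x x ⟩
    x               ∎

  conj-0 : conj 0# ≈ 0#
  conj-0 = x+x≈x⇒x≈0 (conj 0#) (trans (sym (conj-+ 0# 0#)) (conj-cong (+-identityʳ 0#)))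

  conj-1 : conj 1# ≈ 1#
  conj-1 = trans (conj≈^q 1#) (1^n≈1 q)
    where
    1^n≈1 : ∀ n → 1# ^ n ≈ 1#
    1^n≈1 zero = refl
    1^n≈1 (suc n) = trans (*-identityˡ _) (1^n≈1 n)

  conj‿- : ∀ x → conj (- x) ≈ - conj x
  conj‿- x = +-inverseʳ-unique (conj x) (conj (- x)) (trans (sym (conj-+ x (- x))) (trans (conj-cong (-‿inverseʳ x)) conj-0))

  conj-- : ∀ x y → conj (x - y) ≈ conj x - conj y
  conj-- x y = trans (conj-+ x (- y)) (+-congˡ (conj‿- y))

  InGFq-cong : ∀ {x y} → x ≈ y → InGFq x → InGFq y
  InGFq-cong x≈y x∈K = trans (conj-cong (sym x≈y)) (trans x∈K x≈y)

  InGFq-0 : InGFq 0#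
  InGFq-0 = conj-0

  InGFq-1 : InGFq 1#
  InGFq-1 = conj-1

  InGFq-inverse : ∀ {a a⁻¹} → InGFq a → a * a⁻¹ ≈ 1# → InGFq a⁻¹
  InGFq-inverse {a} {a⁻¹} a∈K aa⁻¹≈1 = *-cancelˡ a≉0 (begin
    a * conj a⁻¹        ≈⟨ *-congʳ (sym a∈K) ⟩
    conj a * conj a⁻¹   ≈⟨ sym (conj-* a a⁻¹) ⟩
    conj (a * a⁻¹)      ≈⟨ trans (conj-cong aa⁻¹≈1) conj-1 ⟩
    1#                  ≈⟨ sym aa⁻¹≈1 ⟩
    a * a⁻¹             ∎)
    where
    a≉0 : ¬ a ≈ 0#
    a≉0 a≈0 = 1≉0 (trans (sym aa⁻¹≈1) (trans (*-congʳ a≈0) (zeroˡ a⁻¹)))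

  2≉0 : ¬ 1# + 1# ≈ 0#
  2≉0 = odd-characteristic⇒2≉0 {p} p-odd p×1≈0

  module _ (f g : Carrier) where

    lin-cong : ∀ {x y} → x ≈ y → lin f g x ≈ lin f g y
    lin-cong x≈y = +-cong (*-congˡ x≈y) (*-congˡ (conj-cong x≈y))

    lin-+ : ∀ x y → lin f g (x + y) ≈ lin f g x + lin f g y
    lin-+ x y = trans (+-congˡ (*-congˡ (conj-+ x y)))
      (solve 6 (λ f g x y x̄ ȳ → f :* (x :+ y) :+ g :* (x̄ :+ ȳ) := (f :* x :+ g :* x̄) :+ (f :* y :+ g :* ȳ))
        refl f g x y (conj x) (conj y))

    lin-- : ∀ x y → lin f g (x - y) ≈ lin f g x - lin f g y
    lin-- x y = trans (+-congˡ (*-congˡ (conj-- x y)))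
      (solve 6 (λ f g x y x̄ ȳ → f :* (x :- y) :+ g :* (x̄ :- ȳ) := (f :* x :+ g :* x̄) :- (f :* y :+ g :* ȳ))
        refl f g x y (conj x) (conj y))

    lin-0 : lin f g 0# ≈ 0#
    lin-0 = trans (+-cong (zeroʳ f) (trans (*-congˡ conj-0) (zeroʳ g))) (+-identityʳ 0#)

    lin-* : ∀ {a} x → InGFq a → lin f g (a * x) ≈ a * lin f g x
    lin-* {a} x a∈K = trans (+-congˡ (*-congˡ (trans (conj-* a x) (*-congʳ a∈K))))
      (solve 5 (λ f g a x x̄ → f :* (a :* x) :+ g :* (a :* x̄) := a :* (f :* x :+ g :* x̄)) refl f g a x (conj x))

    lin-linear : ∀ {a b} x y → InGFq a → InGFq b → lin f g (a * x + b * y) ≈ a * lin f g x + b * lin f g y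
    lin-linear x y a∈K b∈K = trans (lin-+ _ _) (+-cong (lin-* x a∈K) (lin-* y b∈K))

    conj-lin : ∀ x → conj (lin f g x) ≈ conj f * conj x + conj g * x
    conj-lin x = trans (conj-+ _ _) (+-cong (conj-* f x) (trans (conj-* g (conj x)) (*-congˡ (conj-involutive x))))

  x+x≈0⇒x≈0 : ∀ {x} → x + x ≈ 0# → x ≈ 0#
  x+x≈0⇒x≈0 {x} x+x≈0 with x*y≈0⇒x≈0⊎y≈0 (trans (distribʳ x 1# 1#) (trans (+-cong (*-identityˡ x) (*-identityˡ x)) x+x≈0))
  ... | inj₁ 2≈0 = ⊥-elim (2≉0 2≈0)
  ... | inj₂ x≈0 = x≈0

  x+y≈0∧x-y≈0⇒x≈0∧y≈0 : ∀ {x y} → x + y ≈ 0# → x - y ≈ 0# → x ≈ 0# × y ≈ 0#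
  x+y≈0∧x-y≈0⇒x≈0∧y≈0 {x} {y} x+y≈0 x-y≈0 = x≈0 , (begin
    y               ≈⟨ solve 2 (λ x y → y := (x :+ y) :- x) refl x y ⟩
    (x + y) - x     ≈⟨ +-cong x+y≈0 (-‿cong x≈0) ⟩
    0# - 0#         ≈⟨ -‿inverseʳ 0# ⟩
    0#              ∎)
    where
    x≈0 : x ≈ 0#
    x≈0 = x+x≈0⇒x≈0 (begin
      x + x                 ≈⟨ solve 2 (λ x y → x :+ x := (x :+ y) :+ (x :- y)) refl x y ⟩
      (x + y) + (x - y)     ≈⟨ +-cong x+y≈0 x-y≈0 ⟩
      0# + 0#               ≈⟨ +-identityʳ 0# ⟩
      0#                    ∎)

  -- If every element were fixed by conj, any two vectors of the image of
  -- x ↦ (F₀ x , F₁ x , F₂ x) would be dependent over GF(q).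
  Dim2-L⇒∃∉GFq : ∀ {f₀ g₀ f₁ g₁ f₂ g₂} → Dim2 (L (lin f₀ g₀) (lin f₁ g₁) (lin f₂ g₂)) → ∃ λ ω → ¬ InGFq ω
  Dim2-L⇒∃∉GFq {f₀} {g₀} {f₁} {g₁} {f₂} {g₂} (u , w , independent , member , _) =
    Product.map element (λ ¬∈K → ¬∈K)
      (Fin.¬∀⟶∃¬ (q *ℕ q) (λ i → InGFq (element i)) (λ i → conj (element i) ≟ element i) not-all)
    where
    x₁ = proj₁ (member 1# 0# InGFq-1 InGFq-0)
    u≈Fx₁ = proj₂ (member 1# 0# InGFq-1 InGFq-0)
    x₂ = proj₁ (member 0# 1# InGFq-0 InGFq-1)
    w≈Fx₂ = proj₂ (member 0# 1# InGFq-0 InGFq-1)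

    dependence : ∀ {s t A} r → 1# * s + 0# * t ≈ A → 0# * s + 1# * t ≈ r * A → (- r) * s + 1# * t ≈ 0#
    dependence {s} {t} {A} r s≈A t≈rA = begin
      (- r) * s + 1# * t   ≈⟨ +-cong (*-congˡ (trans (sym 1s+0t≈s) s≈A)) (trans (sym 0s+1t≈t) t≈rA) ⟩
      (- r) * A + r * A    ≈⟨ sym (distribʳ A (- r) r) ⟩
      (- r + r) * A        ≈⟨ *-congʳ (-‿inverseˡ r) ⟩
      0# * A               ≈⟨ zeroˡ A ⟩
      0#                   ∎
      where
      1s+0t≈s : 1# * s + 0# * t ≈ s
      1s+0t≈s = trans (+-cong (*-identityˡ s) (zeroˡ t)) (+-identityʳ s)
      0s+1t≈t : 0# * s + 1# * t ≈ 1# * t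
      0s+1t≈t = trans (+-congʳ (zeroˡ s)) (+-identityˡ _)

    not-all : ¬ (∀ i → InGFq (element i))
    not-all all-eᵢ∈K with x₁ ≟ 0#
    ... | yes x₁≈0 = 1≉0 (proj₁ (independent 1# 0# InGFq-1 InGFq-0
          ( trans (proj₁ u≈Fx₁) (trans (lin-cong f₀ g₀ x₁≈0) (lin-0 f₀ g₀))
          , trans (proj₁ (proj₂ u≈Fx₁)) (trans (lin-cong f₁ g₁ x₁≈0) (lin-0 f₁ g₁))
          , trans (proj₂ (proj₂ u≈Fx₁)) (trans (lin-cong f₂ g₂ x₁≈0) (lin-0 f₂ g₂)))))
    ... | no x₁≉0 = 1≉0 (proj₂ (independent (- r) 1# (all∈K (- r)) InGFq-1
          ( dependence r (proj₁ u≈Fx₁) (trans (proj₁ w≈Fx₂) (Fx₂≈rFx₁ f₀ g₀))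
          , dependence r (proj₁ (proj₂ u≈Fx₁)) (trans (proj₁ (proj₂ w≈Fx₂)) (Fx₂≈rFx₁ f₁ g₁))
          , dependence r (proj₂ (proj₂ u≈Fx₁)) (trans (proj₂ (proj₂ w≈Fx₂)) (Fx₂≈rFx₁ f₂ g₂)))))
      where
      all∈K : ∀ x → InGFq x
      all∈K x = InGFq-cong (proj₂ (element-surjective x)) (all-eᵢ∈K _)
      x₁⁻¹ = proj₁ (∃-inverse x₁ x₁≉0)
      r = x₂ * x₁⁻¹
      x₂≈rx₁ : x₂ ≈ r * x₁
      x₂≈rx₁ = sym (trans (*-assoc x₂ x₁⁻¹ x₁)
        (trans (*-congˡ (trans (*-comm x₁⁻¹ x₁) (proj₂ (∃-inverse x₁ x₁≉0)))) (*-identityʳ x₂)))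
      Fx₂≈rFx₁ : ∀ f g → lin f g x₂ ≈ r * lin f g x₁
      Fx₂≈rFx₁ f g = trans (lin-cong f g x₂≈rx₁) (lin-* f g x₁ (all∈K r))

module QuadraticExtension {c ℓ : Level} (R : CommutativeRing c ℓ) (q : ℕ) (q-odd : OddPrimePower q)
                          (isField : Geometry.IsField R) (size : Geometry.HasSize R (q *ℕ q))
                          (ω : CommutativeRing.Carrier R) (ω∉K : ¬ Geometry.WithQ.InGFq R q ω) where
  open Product using (_×_)
  open CommutativeRing R
  open Geometry R
  open WithQ q
  open Conjugation R q q-odd isField size public
  open SetoidReasoning setoid
  open RingProperties ring using (-‿distribʳ-*; -0#≈0#; x∙y⁻¹≈ε⇒x≈y)
  open IntegerSolver R using (solve; _:=_; _:+_; _:*_; :-_; _:-_)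

  Δ : Carrier
  Δ = ω - conj ω

  Δ≉0 : ¬ Δ ≈ 0#
  Δ≉0 Δ≈0 = ω∉K (sym (x∙y⁻¹≈ε⇒x≈y ω (conj ω) Δ≈0))

  conj-Δ : conj Δ ≈ - Δ
  conj-Δ = trans (conj-- ω (conj ω)) (trans (+-congˡ (-‿cong (conj-involutive ω)))
    (solve 2 (λ ω ω̄ → ω̄ :- ω := :- (ω :- ω̄)) refl ω (conj ω)))

  x*Δ≈0⇒x≈0 : ∀ {x} → x * Δ ≈ 0# → x ≈ 0#
  x*Δ≈0⇒x≈0 xΔ≈0 with x*y≈0⇒x≈0⊎y≈0 xΔ≈0
  ... | inj₁ x≈0 = x≈0
  ... | inj₂ Δ≈0 = ⊥-elim (Δ≉0 Δ≈0)

  τ : Carrier → Carrier → Carrier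
  τ a b = a * conj b + conj a * b

  -- Testing against r = 1 gives ȳ = − y, and then r = ω gives y Δ = 0.
  τ-nondegenerate : ∀ {y} → (∀ r → τ y r ≈ 0#) → y ≈ 0#
  τ-nondegenerate {y} ⊥y = x*Δ≈0⇒x≈0 (begin
    y * Δ                                           ≈⟨ solve 4 (λ y ȳ ω ω̄ → y :* (ω :- ω̄) := (ȳ :+ y) :* ω :- (y :* ω̄ :+ ȳ :* ω)) refl y (conj y) ω (conj ω) ⟩
    (conj y + y) * ω - (y * conj ω + conj y * ω)     ≈⟨ +-cong (trans (*-congʳ ȳ+y≈0) (zeroˡ ω)) (-‿cong (⊥y ω)) ⟩
    0# - 0#                                         ≈⟨ trans (+-identityˡ _) -0#≈0# ⟩
    0#                                              ∎)
    where
    ȳ+y≈0 : conj y + y ≈ 0#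
    ȳ+y≈0 = trans (+-comm _ _) (trans (+-cong (sym (trans (*-congˡ conj-1) (*-identityʳ y))) (sym (*-identityʳ _))) (⊥y 1#))

  t̄s-ts̄≈0⇒t≈0 : ∀ {t} → (∀ s → conj t * s - t * conj s ≈ 0#) → t ≈ 0#
  t̄s-ts̄≈0⇒t≈0 {t} t̄s≈ts̄ = x*Δ≈0⇒x≈0 (begin
    t * Δ                                          ≈⟨ rearrange t (conj t) ω (conj ω) ⟩
    (conj t * ω - t * conj ω) + (t - conj t) * ω   ≈⟨ +-cong (t̄s≈ts̄ ω) (*-congʳ t-t̄≈0) ⟩
    0# + 0# * ω                                    ≈⟨ trans (+-identityˡ _) (zeroˡ ω) ⟩
    0#                                             ∎)
    where
    rearrange : ∀ t t̄ ω ω̄ → t * (ω - ω̄) ≈ (t̄ * ω - t * ω̄) + (t - t̄) * ω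
    rearrange = solve 4 (λ t t̄ ω ω̄ → t :* (ω :- ω̄) := (t̄ :* ω :- t :* ω̄) :+ (t :- t̄) :* ω) refl
    t-t̄≈0 : t - conj t ≈ 0#
    t-t̄≈0 = begin
      t - conj t                  ≈⟨ solve 2 (λ t t̄ → t :- t̄ := :- (t̄ :- t)) refl t (conj t) ⟩
      - (conj t - t)              ≈⟨ -‿cong (+-cong (sym (*-identityʳ _)) (-‿cong (sym (trans (*-congˡ conj-1) (*-identityʳ t))))) ⟩
      - (conj t * 1# - t * conj 1#) ≈⟨ -‿cong (t̄s≈ts̄ 1#) ⟩
      - 0#                        ≈⟨ -0#≈0# ⟩
      0#                          ∎

  private
    Δ⁻¹ = proj₁ (∃-inverse Δ Δ≉0)
    ΔΔ⁻¹≈1 = proj₂ (∃-inverse Δ Δ≉0)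

    conj-Δ⁻¹ : conj Δ⁻¹ ≈ - Δ⁻¹
    conj-Δ⁻¹ = *-cancelˡ Δ≉0 (begin
      Δ * conj Δ⁻¹            ≈⟨ solve 2 (λ d x → d :* x := :- ((:- d) :* x)) refl Δ (conj Δ⁻¹) ⟩
      - (- Δ * conj Δ⁻¹)      ≈⟨ -‿cong (*-congʳ (sym conj-Δ)) ⟩
      - (conj Δ * conj Δ⁻¹)   ≈⟨ -‿cong (trans (sym (conj-* Δ Δ⁻¹)) (trans (conj-cong ΔΔ⁻¹≈1) conj-1)) ⟩
      - 1#                    ≈⟨ -‿cong (sym ΔΔ⁻¹≈1) ⟩
      - (Δ * Δ⁻¹)             ≈⟨ -‿distribʳ-* Δ Δ⁻¹ ⟩
      Δ * - Δ⁻¹               ∎)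

  -- b = (x − x̄)/Δ and a = x − b ω; both are fixed because numerator and
  -- denominator of b are anti-fixed.
  decompose : ∀ x → ∃₂ λ a b → InGFq a × InGFq b × x ≈ a + b * ω
  decompose x = x - b * ω , b , a∈K , b∈K , solve 3 (λ x b ω → x := (x :- b :* ω) :+ b :* ω) refl x b ω
    where
    b = (x - conj x) * Δ⁻¹
    b∈K : InGFq b
    b∈K = begin
      conj ((x - conj x) * Δ⁻¹)            ≈⟨ conj-* _ _ ⟩
      conj (x - conj x) * conj Δ⁻¹         ≈⟨ *-cong (trans (conj-- x (conj x)) (+-congˡ (-‿cong (conj-involutive x)))) conj-Δ⁻¹ ⟩
      (conj x - x) * - Δ⁻¹                 ≈⟨ solve 3 (λ x x̄ d → (x̄ :- x) :* (:- d) := (x :- x̄) :* d) refl x (conj x) Δ⁻¹ ⟩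
      b                                    ∎
    rearrange : ∀ x x̄ b ω ω̄ → x̄ - b * ω̄ ≈ (x - b * ω) + (b * (ω - ω̄) - (x - x̄))
    rearrange = solve 5 (λ x x̄ b ω ω̄ → x̄ :- b :* ω̄ := (x :- b :* ω) :+ (b :* (ω :- ω̄) :- (x :- x̄))) refl
    bΔ≈x-x̄ : b * Δ ≈ x - conj x
    bΔ≈x-x̄ = trans (*-assoc _ _ _) (trans (*-congˡ (trans (*-comm Δ⁻¹ Δ) ΔΔ⁻¹≈1)) (*-identityʳ _))
    a∈K : InGFq (x - b * ω)
    a∈K = begin
      conj (x - b * ω)                               ≈⟨ trans (conj-- x (b * ω)) (+-congˡ (-‿cong (trans (conj-* b ω) (*-congʳ b∈K)))) ⟩
      conj x - b * conj ω                            ≈⟨ rearrange x (conj x) b ω (conj ω) ⟩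
      (x - b * ω) + (b * Δ - (x - conj x))           ≈⟨ +-congˡ (trans (+-congʳ bΔ≈x-x̄) (-‿inverseʳ _)) ⟩
      (x - b * ω) + 0#                               ≈⟨ +-identityʳ _ ⟩
      x - b * ω                                      ∎

  independent : ∀ {a b} → InGFq a → InGFq b → a + b * ω ≈ 0# → a ≈ 0# × b ≈ 0#
  independent {a} {b} a∈K b∈K a+bω≈0 = a≈0 , b≈0
    where
    a+bω̄≈0 : a + b * conj ω ≈ 0#
    a+bω̄≈0 = begin
      a + b * conj ω              ≈⟨ +-cong (sym a∈K) (*-congʳ (sym b∈K)) ⟩
      conj a + conj b * conj ω    ≈⟨ +-congˡ (sym (conj-* b ω)) ⟩
      conj a + conj (b * ω)       ≈⟨ sym (conj-+ a (b * ω)) ⟩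
      conj (a + b * ω)            ≈⟨ trans (conj-cong a+bω≈0) conj-0 ⟩
      0#                          ∎
    b≈0 : b ≈ 0#
    b≈0 = x*Δ≈0⇒x≈0 (begin
      b * Δ                             ≈⟨ solve 4 (λ a b ω ω̄ → b :* (ω :- ω̄) := (a :+ b :* ω) :- (a :+ b :* ω̄)) refl a b ω (conj ω) ⟩
      (a + b * ω) - (a + b * conj ω)    ≈⟨ +-cong a+bω≈0 (-‿cong a+bω̄≈0) ⟩
      0# - 0#                           ≈⟨ trans (+-identityˡ _) -0#≈0# ⟩
      0#                                ∎)
    a≈0 : a ≈ 0#
    a≈0 = trans (sym (trans (+-congˡ (trans (*-congʳ b≈0) (zeroˡ ω))) (+-identityʳ a))) a+bω≈0

  -- A nonzero kernel vector t would make GF(q²) = GF(q) t + GF(q) ω t, so the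
  -- image would be GF(q) F(ω t); surjectivity then puts both 1 and ω there.
  lin-surjective⇒injective : ∀ f g → (∀ r → ∃ λ s → lin f g s ≈ r) → ∀ {t} → lin f g t ≈ 0# → t ≈ 0#
  lin-surjective⇒injective f g surjective {t} Ft≈0 with t ≟ 0#
  ... | yes t≈0 = t≈0
  ... | no t≉0 = ⊥-elim (ω∉K (begin
    conj ω                      ≈⟨ conj-cong (sym b₂W≈ω) ⟩
    conj (b₂ * W)               ≈⟨ conj-* b₂ W ⟩
    conj b₂ * conj W            ≈⟨ *-cong b₂∈K (InGFq-inverse b₁∈K b₁W≈1) ⟩
    b₂ * W                      ≈⟨ b₂W≈ω ⟩
    ω                           ∎))
    where
    t⁻¹ = proj₁ (∃-inverse t t≉0)
    tt⁻¹≈1 = proj₂ (∃-inverse t t≉0)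
    W = lin f g (ω * t)
    image⊆KW : ∀ s → ∃ λ b → InGFq b × lin f g s ≈ b * W
    image⊆KW s = coordinates (decompose (s * t⁻¹))
      where
      coordinates : (∃₂ λ a b → InGFq a × InGFq b × s * t⁻¹ ≈ a + b * ω) → ∃ λ b → InGFq b × lin f g s ≈ b * W
      coordinates (a , b , a∈K , b∈K , st⁻¹≈a+bω) = b , b∈K , (begin
        lin f g s                          ≈⟨ lin-cong f g s≈at+bωt ⟩
        lin f g (a * t + b * (ω * t))      ≈⟨ lin-linear f g t (ω * t) a∈K b∈K ⟩
        a * lin f g t + b * W              ≈⟨ +-congʳ (trans (*-congˡ Ft≈0) (zeroʳ a)) ⟩
        0# + b * W                         ≈⟨ +-identityˡ _ ⟩
        b * W                              ∎)
        where
        distribute : ∀ a b ω t → (a + b * ω) * t ≈ a * t + b * (ω * t)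
        distribute = solve 4 (λ a b ω t → (a :+ b :* ω) :* t := a :* t :+ b :* (ω :* t)) refl
        s≈at+bωt : s ≈ a * t + b * (ω * t)
        s≈at+bωt = begin
          s                    ≈⟨ sym (trans (*-assoc s t⁻¹ t) (trans (*-congˡ (trans (*-comm t⁻¹ t) tt⁻¹≈1)) (*-identityʳ s))) ⟩
          (s * t⁻¹) * t        ≈⟨ *-congʳ st⁻¹≈a+bω ⟩
          (a + b * ω) * t      ≈⟨ distribute a b ω t ⟩
          a * t + b * (ω * t)  ∎
    preimage : ∀ r → ∃ λ b → InGFq b × b * W ≈ r
    preimage r =
      let s , Fs≈r = surjective r
          b , b∈K , Fs≈bW = image⊆KW s
      in b , b∈K , trans (sym Fs≈bW) Fs≈r
    b₁ = proj₁ (preimage 1#)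
    b₁∈K = proj₁ (proj₂ (preimage 1#))
    b₁W≈1 = proj₂ (proj₂ (preimage 1#))
    b₂ = proj₁ (preimage ω)
    b₂∈K = proj₁ (proj₂ (preimage ω))
    b₂W≈ω = proj₂ (proj₂ (preimage ω))

module Polarity {c ℓ : Level} (R : CommutativeRing c ℓ) (q : ℕ) (q-odd : OddPrimePower q)
                (isField : Geometry.IsField R) (size : Geometry.HasSize R (q *ℕ q))
                (ω : CommutativeRing.Carrier R) (ω∉K : ¬ Geometry.WithQ.InGFq R q ω) where
  open Product using (_×_)
  open CommutativeRing R
  open Geometry R
  open WithQ q
  open QuadraticExtension R q q-odd isField size ω ω∉K public
  open SetoidReasoning setoid
  open RingProperties ring using (-0#≈0#; -‿involutive)
  open IntegerSolver R using (solve; _:=_; _:+_; _:*_; :-_; _:-_)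

  ≈ᵥ-sym : ∀ {u w} → u ≈ᵥ w → w ≈ᵥ u
  ≈ᵥ-sym (x≈ , y≈ , z≈) = sym x≈ , sym y≈ , sym z≈

  ≈ᵥ-trans : ∀ {u v w} → u ≈ᵥ v → v ≈ᵥ w → u ≈ᵥ w
  ≈ᵥ-trans (x≈ , y≈ , z≈) (x≈' , y≈' , z≈') = trans x≈ x≈' , trans y≈ y≈' , trans z≈ z≈'

  τ-cong : ∀ {a a' b b'} → a ≈ a' → b ≈ b' → τ a b ≈ τ a' b'
  τ-cong a≈ b≈ = +-cong (*-cong a≈ (conj-cong b≈)) (*-cong (conj-cong a≈) b≈)

  τ-zeroˡ : ∀ b → τ 0# b ≈ 0#
  τ-zeroˡ b = trans (+-cong (zeroˡ _) (trans (*-congʳ conj-0) (zeroˡ b))) (+-identityʳ 0#)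

  τ-zeroʳ : ∀ a → τ a 0# ≈ 0#
  τ-zeroʳ a = trans (+-cong (trans (*-congˡ conj-0) (zeroʳ a)) (zeroʳ _)) (+-identityʳ 0#)

  τ-+ˡ : ∀ a b c' → τ (a + b) c' ≈ τ a c' + τ b c'
  τ-+ˡ a b c' = trans (+-congˡ (*-congʳ (conj-+ a b))) (distribute a b c' (conj a) (conj b) (conj c'))
    where
    distribute : ∀ a b c' ā b̄ c̄ → (a + b) * c̄ + (ā + b̄) * c' ≈ (a * c̄ + ā * c') + (b * c̄ + b̄ * c')
    distribute = solve 6 (λ a b c' ā b̄ c̄ → (a :+ b) :* c̄ :+ (ā :+ b̄) :* c' := (a :* c̄ :+ ā :* c') :+ (b :* c̄ :+ b̄ :* c')) refl

  τ--ˡ : ∀ a b c' → τ (a - b) c' ≈ τ a c' - τ b c'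
  τ--ˡ a b c' = trans (+-congˡ (*-congʳ (conj-- a b))) (distribute a b c' (conj a) (conj b) (conj c'))
    where
    distribute : ∀ a b c' ā b̄ c̄ → (a - b) * c̄ + (ā - b̄) * c' ≈ (a * c̄ + ā * c') - (b * c̄ + b̄ * c')
    distribute = solve 6 (λ a b c' ā b̄ c̄ → (a :- b) :* c̄ :+ (ā :- b̄) :* c' := (a :* c̄ :+ ā :* c') :- (b :* c̄ :+ b̄ :* c')) refl

  Bf-expand : ∀ u w → Bf u w ≈ (τ (vy u) (vy w) - τ (vx u) (vz w)) - τ (vz u) (vx w)
  Bf-expand ⟨ x , y , z ⟩ ⟨ x' , y' , z' ⟩ =
    solve 12 (λ x x̄ y ȳ z z̄ x' x̄' y' ȳ' z' z̄' →
      ((((:- (x :* z̄') :- x̄ :* z') :+ y :* ȳ') :+ ȳ :* y') :- z :* x̄') :- z̄ :* x'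
      := ((y :* ȳ' :+ ȳ :* y') :- (x :* z̄' :+ x̄ :* z')) :- (z :* x̄' :+ z̄ :* x'))
      refl x (conj x) y (conj y) z (conj z) x' (conj x') y' (conj y') z' (conj z')

  Bf-cong : ∀ {u u' w w'} → u ≈ᵥ u' → w ≈ᵥ w' → Bf u w ≈ Bf u' w'
  Bf-cong {u} {u'} {w} {w'} (x≈ , y≈ , z≈) (x≈' , y≈' , z≈') = begin
    Bf u w                                            ≈⟨ Bf-expand u w ⟩
    (τ (vy u) (vy w) - τ (vx u) (vz w)) - τ (vz u) (vx w)
      ≈⟨ +-cong (+-cong (τ-cong y≈ y≈') (-‿cong (τ-cong x≈ z≈'))) (-‿cong (τ-cong z≈ x≈')) ⟩
    (τ (vy u') (vy w') - τ (vx u') (vz w')) - τ (vz u') (vx w') ≈⟨ sym (Bf-expand u' w') ⟩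
    Bf u' w'                                          ∎

  Qf-cong : ∀ {u u'} → u ≈ᵥ u' → Qf u ≈ Qf u'
  Qf-cong (x≈ , y≈ , z≈) =
    +-cong (+-cong (-‿cong (*-cong x≈ (conj-cong z≈))) (-‿cong (*-cong (conj-cong x≈) z≈))) (*-cong y≈ (conj-cong y≈))

  Qf-+ : ∀ u w → Qf (u +ᵥ w) ≈ (Qf u + Qf w) + Bf u w
  Qf-+ ⟨ x , y , z ⟩ ⟨ x' , y' , z' ⟩ = trans
    (+-cong (+-cong (-‿cong (*-congˡ (conj-+ z z'))) (-‿cong (*-congʳ (conj-+ x x')))) (*-congˡ (conj-+ y y')))
    (solve 12 (λ x x̄ y ȳ z z̄ x' x̄' y' ȳ' z' z̄' →
      (:- ((x :+ x') :* (z̄ :+ z̄')) :- (x̄ :+ x̄') :* (z :+ z')) :+ (y :+ y') :* (ȳ :+ ȳ')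
      := ((:- (x :* z̄) :- x̄ :* z) :+ y :* ȳ) :+ ((:- (x' :* z̄') :- x̄' :* z') :+ y' :* ȳ')
         :+ (((((:- (x :* z̄') :- x̄ :* z') :+ y :* ȳ') :+ ȳ :* y') :- z :* x̄') :- z̄ :* x'))
      refl x (conj x) y (conj y) z (conj z) x' (conj x') y' (conj y') z' (conj z'))

  ⊥-resp-≈ᵥ : ∀ {W u u'} → u ≈ᵥ u' → (W ⊥) u → (W ⊥) u'
  ⊥-resp-≈ᵥ u≈u' u⊥W w w∈W = trans (Bf-cong (≈ᵥ-sym u≈u') (refl , refl , refl)) (u⊥W w w∈W)

  Bf-x-axis : ∀ u x → Bf u ⟨ x , 0# , 0# ⟩ ≈ - τ (vz u) x
  Bf-x-axis u x = begin
    Bf u ⟨ x , 0# , 0# ⟩                           ≈⟨ Bf-expand u _ ⟩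
    (τ (vy u) 0# - τ (vx u) 0#) - τ (vz u) x       ≈⟨ +-congʳ (+-cong (τ-zeroʳ _) (-‿cong (τ-zeroʳ _))) ⟩
    (0# - 0#) - τ (vz u) x                         ≈⟨ trans (+-congʳ (-‿inverseʳ 0#)) (+-identityˡ _) ⟩
    - τ (vz u) x                                   ∎

  Bf-z-axis : ∀ u z → Bf u ⟨ 0# , 0# , z ⟩ ≈ - τ (vx u) z
  Bf-z-axis u z = begin
    Bf u ⟨ 0# , 0# , z ⟩                           ≈⟨ Bf-expand u _ ⟩
    (τ (vy u) 0# - τ (vx u) z) - τ (vz u) 0#       ≈⟨ +-cong (+-congʳ (τ-zeroʳ _)) (-‿cong (τ-zeroʳ _)) ⟩
    (0# - τ (vx u) z) - 0#                         ≈⟨ trans (+-congˡ -0#≈0#) (trans (+-identityʳ _) (+-identityˡ _)) ⟩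
    - τ (vx u) z                                   ∎

  private
    -x≈0⇒x≈0 : ∀ {x} → - x ≈ 0# → x ≈ 0#
    -x≈0⇒x≈0 {x} -x≈0 = trans (sym (-‿involutive x)) (trans (-‿cong -x≈0) -0#≈0#)

    x≈0⇒-τ≈0 : ∀ {x} y → x ≈ 0# → - τ x y ≈ 0#
    x≈0⇒-τ≈0 y x≈0 = trans (-‿cong (trans (τ-cong x≈0 refl) (τ-zeroˡ y))) -0#≈0#

  ⊥l⇒z≈0 : ∀ {u} → (L I O O ⊥) u → vz u ≈ 0#
  ⊥l⇒z≈0 {u} u⊥l = τ-nondegenerate λ x → -x≈0⇒x≈0 (trans (sym (Bf-x-axis u x)) (u⊥l _ (x , refl , refl , refl)))

  ⊥m⇒x≈0 : ∀ {u} → (L O O I ⊥) u → vx u ≈ 0#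
  ⊥m⇒x≈0 {u} u⊥m = τ-nondegenerate λ z → -x≈0⇒x≈0 (trans (sym (Bf-z-axis u z)) (u⊥m _ (z , refl , refl , refl)))

  z≈0⇒⊥l : ∀ {u} → vz u ≈ 0# → (L I O O ⊥) u
  z≈0⇒⊥l {u} z≈0 w (x , w≈) = trans (Bf-cong (refl , refl , refl) w≈) (trans (Bf-x-axis u x) (x≈0⇒-τ≈0 x z≈0))

  x≈0⇒⊥m : ∀ {u} → vx u ≈ 0# → (L O O I ⊥) u
  x≈0⇒⊥m {u} x≈0 w (z , w≈) = trans (Bf-cong (refl , refl , refl) w≈) (trans (Bf-z-axis u z) (x≈0⇒-τ≈0 z x≈0))

  Dim2⇒nonzero : ∀ {W} → Dim2 W → ¬ (∀ v → W v → v ≈ᵥ 0ᵥ)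
  Dim2⇒nonzero (u , w , independent , member , _) W≈0 =
    1≉0 (proj₁ (independent 1# 0# InGFq-1 InGFq-0 (W≈0 _ (member 1# 0# InGFq-1 InGFq-0))))

module Configuration {c ℓ : Level} (R : CommutativeRing c ℓ) (q : ℕ) (q-odd : OddPrimePower q)
                     (isField : Geometry.IsField R) (size : Geometry.HasSize R (q *ℕ q))
                     (f₀ g₀ f₁ g₁ f₂ g₂ : CommutativeRing.Carrier R) where
  open Product using (_×_)
  open CommutativeRing R
  open Geometry R
  open WithQ q

  F₀ F₁ F₂ : Carrier → Carrier
  F₀ = lin f₀ g₀
  F₁ = lin f₁ g₁
  F₂ = lin f₂ g₂

  l m n : Sub
  l = L I O O
  m = L O O I
  n = L F₀ F₁ F₂

  -- InPerspective l m n unfolds to Dim2 Σ₁₂₃.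
  Σ₁ Σ₂ Σ₃ Σ₁₂₃ : Sub
  Σ₁ = ⟨ (m ⊥) ∩ (n ⊥) ⸴ l ⟩
  Σ₂ = ⟨ (l ⊥) ∩ (n ⊥) ⸴ m ⟩
  Σ₃ = ⟨ (l ⊥) ∩ (m ⊥) ⸴ n ⟩
  Σ₁₂₃ = (Σ₁ ∩ Σ₂) ∩ Σ₃

  γ : Carrier
  γ = conj f₀ * f₂ + g₀ * conj g₂

  module _ (n-line : IsLine n) (span : SpanAll l m n) where
    private
      ∃ω∉K : ∃ λ ω → ¬ InGFq ω
      ∃ω∉K = Conjugation.Dim2-L⇒∃∉GFq R q q-odd isField size (proj₂ n-line)

    ω : Carrier
    ω = proj₁ ∃ω∉K

    open Polarity R q q-odd isField size ω (proj₂ ∃ω∉K)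
    open SetoidReasoning setoid
    open RingProperties ring using (-0#≈0#) renaming (x∙y⁻¹≈ε⇒x≈y to x-y≈0⇒x≈y; x≈y⇒x∙y⁻¹≈ε to x≈y⇒x-y≈0)
    open IntegerSolver R using (solve; _:=_; _:+_; _:*_; :-_; _:-_)

    F : Carrier → V
    F t = ⟨ F₀ t , F₁ t , F₂ t ⟩

    F∈n : ∀ t → n (F t)
    F∈n t = t , refl , refl , refl

    ⊥n⇒ : ∀ {u} → (n ⊥) u → ∀ s → Bf u (F s) ≈ 0#
    ⊥n⇒ u⊥n s = u⊥n (F s) (F∈n s)

    ⇒⊥n : ∀ {u} → (∀ s → Bf u (F s) ≈ 0#) → (n ⊥) u
    ⇒⊥n ⊥F w (s , w≈Fs) = trans (Bf-cong (refl , refl , refl) w≈Fs) (⊥F s)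

    -- n is totally singular and closed under addition, so polarisation kills b̂ on it.
    n-isotropic : ∀ t s → Bf (F t) (F s) ≈ 0#
    n-isotropic t s = begin
      Bf (F t) (F s)                               ≈⟨ sym (+-identityˡ _) ⟩
      0# + Bf (F t) (F s)                          ≈⟨ +-congʳ (sym (trans (+-cong (Q≈0 t) (Q≈0 s)) (+-identityʳ 0#))) ⟩
      (Qf (F t) + Qf (F s)) + Bf (F t) (F s)       ≈⟨ sym (Qf-+ (F t) (F s)) ⟩
      Qf (F t +ᵥ F s)                              ≈⟨ Qf-cong (≈ᵥ-sym (lin-+ f₀ g₀ t s , lin-+ f₁ g₁ t s , lin-+ f₂ g₂ t s)) ⟩
      Qf (F (t + s))                               ≈⟨ Q≈0 (t + s) ⟩
      0#                                           ∎
      where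
      Q≈0 : ∀ t → Qf (F t) ≈ 0#
      Q≈0 t = proj₁ n-line (F t) (F∈n t)

    F₁-surjective : ∀ r → ∃ λ s → F₁ s ≈ r
    F₁-surjective r =
      let a , b , d , (_ , a≈) , (_ , b≈) , (s , d≈) , r≈ = span ⟨ 0# , r , 0# ⟩
      in s , sym (begin
        r                         ≈⟨ proj₁ (proj₂ r≈) ⟩
        (vy a + vy b) + vy d      ≈⟨ +-cong (trans (+-cong (proj₁ (proj₂ a≈)) (proj₁ (proj₂ b≈))) (+-identityʳ 0#)) (proj₁ (proj₂ d≈)) ⟩
        0# + F₁ s                 ≈⟨ +-identityˡ _ ⟩
        F₁ s                      ∎)

    F₁-cancel : ∀ {t u} → F₁ t ≈ F₁ u → t ≈ u
    F₁-cancel {t} {u} F₁t≈F₁u = x-y≈0⇒x≈y t u (lin-surjective⇒injective f₁ g₁ F₁-surjective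
      (trans (lin-- f₁ g₁ t u) (x≈y⇒x-y≈0 F₁t≈F₁u)))

    D : Carrier → Carrier → Carrier
    D t s = τ (F₀ t) (F₂ s) - τ (F₂ t) (F₀ s)

    conj-γ : conj γ ≈ f₀ * conj f₂ + conj g₀ * g₂
    conj-γ = trans (conj-+ _ _)
      (+-cong (trans (conj-* _ _) (*-congʳ (conj-involutive f₀))) (trans (conj-* _ _) (*-congˡ (conj-involutive g₂))))

    D≈[γ-γ̄]* : ∀ t s → D t s ≈ (γ - conj γ) * (conj t * s - t * conj s)
    D≈[γ-γ̄]* t s = begin
      D t s
        ≈⟨ +-cong (+-cong (*-congˡ (conj-lin f₂ g₂ s)) (*-congʳ (conj-lin f₀ g₀ t)))
                  (-‿cong (+-cong (*-congˡ (conj-lin f₀ g₀ s)) (*-congʳ (conj-lin f₂ g₂ t)))) ⟩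
      ((f₀ * t + g₀ * conj t) * (conj f₂ * conj s + conj g₂ * s) + (conj f₀ * conj t + conj g₀ * t) * (f₂ * s + g₂ * conj s))
        - ((f₂ * t + g₂ * conj t) * (conj f₀ * conj s + conj g₀ * s) + (conj f₂ * conj t + conj g₂ * t) * (f₀ * s + g₀ * conj s))
        ≈⟨ expand f₀ (conj f₀) g₀ (conj g₀) f₂ (conj f₂) g₂ (conj g₂) t (conj t) s (conj s) ⟩
      (γ - (f₀ * conj f₂ + conj g₀ * g₂)) * (conj t * s - t * conj s)
        ≈⟨ *-congʳ (+-congˡ (-‿cong (sym conj-γ))) ⟩
      (γ - conj γ) * (conj t * s - t * conj s) ∎
      where
      expand : ∀ f₀ f̄₀ g₀ ḡ₀ f₂ f̄₂ g₂ ḡ₂ t t̄ s s̄ →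
        ((f₀ * t + g₀ * t̄) * (f̄₂ * s̄ + ḡ₂ * s) + (f̄₀ * t̄ + ḡ₀ * t) * (f₂ * s + g₂ * s̄))
          - ((f₂ * t + g₂ * t̄) * (f̄₀ * s̄ + ḡ₀ * s) + (f̄₂ * t̄ + ḡ₂ * t) * (f₀ * s + g₀ * s̄))
        ≈ ((f̄₀ * f₂ + g₀ * ḡ₂) - (f₀ * f̄₂ + ḡ₀ * g₂)) * (t̄ * s - t * s̄)
      expand = solve 12 (λ f₀ f̄₀ g₀ ḡ₀ f₂ f̄₂ g₂ ḡ₂ t t̄ s s̄ →
        ((f₀ :* t :+ g₀ :* t̄) :* (f̄₂ :* s̄ :+ ḡ₂ :* s) :+ (f̄₀ :* t̄ :+ ḡ₀ :* t) :* (f₂ :* s :+ g₂ :* s̄))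
          :- ((f₂ :* t :+ g₂ :* t̄) :* (f̄₀ :* s̄ :+ ḡ₀ :* s) :+ (f̄₂ :* t̄ :+ ḡ₂ :* t) :* (f₀ :* s :+ g₀ :* s̄))
        := ((f̄₀ :* f₂ :+ g₀ :* ḡ₂) :- (f₀ :* f̄₂ :+ ḡ₀ :* g₂)) :* (t̄ :* s :- t :* s̄)) refl

    private
      left-summand : ∀ {a b c'} → a ≈ b + c' → c' ≈ 0# → b ≈ a
      left-summand a≈b+c c≈0 = sym (trans a≈b+c (trans (+-congˡ c≈0) (+-identityʳ _)))

      right-summand : ∀ {a b c'} → a ≈ b + c' → b ≈ 0# → c' ≈ a
      right-summand a≈b+c b≈0 = sym (trans a≈b+c (trans (+-congʳ b≈0) (+-identityˡ _)))

    -- A point of Σ₃ has the x- and z-coordinates of a point F t of n; its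
    -- components along l^⊥ ∩ n^⊥ and m^⊥ ∩ n^⊥ are then forced.
    Σ₁₂₃⇒⊥n-pair : ∀ {v} → Σ₁₂₃ v → ∃ λ t → vx v ≈ F₀ t × vz v ≈ F₂ t
                   × (n ⊥) ⟨ 0# , vy v , F₂ t ⟩ × (n ⊥) ⟨ F₀ t , vy v , 0# ⟩
    Σ₁₂₃⇒⊥n-pair {v}
      ( ( (w₁ , w₁' , (w₁⊥m , w₁⊥n) , (_ , w₁'≈) , v≈w₁+w₁')
        , (w₂ , w₂' , (w₂⊥l , w₂⊥n) , (_ , w₂'≈) , v≈w₂+w₂') )
      , (w₃ , w₃' , (w₃⊥l , w₃⊥m) , (t , w₃'≈) , v≈w₃+w₃') ) =
      t , x≈F₀t , z≈F₂t
        , ⊥-resp-≈ᵥ ( ⊥m⇒x≈0 w₁⊥m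
                    , left-summand (proj₁ (proj₂ v≈w₁+w₁')) (proj₁ (proj₂ w₁'≈))
                    , trans (left-summand (proj₂ (proj₂ v≈w₁+w₁')) (proj₂ (proj₂ w₁'≈))) z≈F₂t ) w₁⊥n
        , ⊥-resp-≈ᵥ ( trans (left-summand (proj₁ v≈w₂+w₂') (proj₁ w₂'≈)) x≈F₀t
                    , left-summand (proj₁ (proj₂ v≈w₂+w₂')) (proj₁ (proj₂ w₂'≈))
                    , ⊥l⇒z≈0 w₂⊥l ) w₂⊥n
      where
      x≈F₀t : vx v ≈ F₀ t
      x≈F₀t = trans (sym (right-summand (proj₁ v≈w₃+w₃') (⊥m⇒x≈0 w₃⊥m))) (proj₁ w₃'≈)
      z≈F₂t : vz v ≈ F₂ t
      z≈F₂t = trans (sym (right-summand (proj₂ (proj₂ v≈w₃+w₃')) (⊥l⇒z≈0 w₃⊥l))) (proj₂ (proj₂ w₃'≈))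

    ⊥n-pair⇒Σ₁₂₃ : ∀ {v t} → vx v ≈ F₀ t → vz v ≈ F₂ t →
          (n ⊥) ⟨ 0# , vy v , F₂ t ⟩ → (n ⊥) ⟨ F₀ t , vy v , 0# ⟩ → Σ₁₂₃ v
    ⊥n-pair⇒Σ₁₂₃ {v} {t} x≈F₀t z≈F₂t ⊥n₁ ⊥n₂ = (v∈Σ₁ , v∈Σ₂) , v∈Σ₃
      where
      v∈Σ₁ : Σ₁ v
      v∈Σ₁ = ⟨ 0# , vy v , vz v ⟩ , ⟨ vx v , 0# , 0# ⟩
           , (x≈0⇒⊥m refl , ⊥-resp-≈ᵥ (refl , refl , sym z≈F₂t) ⊥n₁)
           , (vx v , refl , refl , refl)
           , (sym (+-identityˡ _) , sym (+-identityʳ _) , sym (+-identityʳ _))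
      v∈Σ₂ : Σ₂ v
      v∈Σ₂ = ⟨ vx v , vy v , 0# ⟩ , ⟨ 0# , 0# , vz v ⟩
           , (z≈0⇒⊥l refl , ⊥-resp-≈ᵥ (sym x≈F₀t , refl , refl) ⊥n₂)
           , (vz v , refl , refl , refl)
           , (sym (+-identityʳ _) , sym (+-identityʳ _) , sym (+-identityˡ _))
      v∈Σ₃ : Σ₃ v
      v∈Σ₃ = ⟨ 0# , vy v - F₁ t , 0# ⟩ , F t
           , (z≈0⇒⊥l refl , x≈0⇒⊥m refl)
           , F∈n t
           , ( trans x≈F₀t (sym (+-identityˡ _))
             , solve 2 (λ y y' → y := (y :- y') :+ y') refl (vy v) (F₁ t)
             , trans z≈F₂t (sym (+-identityˡ _)) )

    private
      x-0≈x : ∀ {a z} → z ≈ 0# → a - z ≈ a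
      x-0≈x z≈0 = trans (+-congˡ (trans (-‿cong z≈0) -0#≈0#)) (+-identityʳ _)

      a+a≈b+c+d⇒a≈0 : ∀ {a b c' d} → a + a ≈ (b + c') + d → b ≈ 0# → c' ≈ 0# → d ≈ 0# → a ≈ 0#
      a+a≈b+c+d⇒a≈0 a+a≈ b≈0 c≈0 d≈0 = x+x≈0⇒x≈0 (trans a+a≈ (trans (+-cong (+-cong b≈0 c≈0) d≈0)
        (trans (+-identityʳ _) (+-identityʳ 0#))))

      a+a≈b+d⇒b≈0 : ∀ {a b d} → a + a ≈ b + d → a ≈ 0# → d ≈ 0# → b ≈ 0#
      a+a≈b+d⇒b≈0 {a} {b} {d} a+a≈b+d a≈0 d≈0 = begin
        b            ≈⟨ sym (+-identityʳ b) ⟩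
        b + 0#       ≈⟨ +-congˡ (sym d≈0) ⟩
        b + d        ≈⟨ sym a+a≈b+d ⟩
        a + a        ≈⟨ trans (+-cong a≈0 a≈0) (+-identityʳ 0#) ⟩
        0#           ∎

    -- Doubling avoids dividing by 2; the last summand vanishes by n-isotropic.
    Bf-0YF₂-twice : ∀ Y t s → Bf ⟨ 0# , Y , F₂ t ⟩ (F s) + Bf ⟨ 0# , Y , F₂ t ⟩ (F s)
                              ≈ (τ ((Y + Y) - F₁ t) (F₁ s) + D t s) + Bf (F t) (F s)
    Bf-0YF₂-twice Y t s = begin
      Bf ⟨ 0# , Y , F₂ t ⟩ (F s) + Bf ⟨ 0# , Y , F₂ t ⟩ (F s)
        ≈⟨ +-cong (trans (Bf-expand _ _) (+-congʳ (x-0≈x (τ-zeroˡ _)))) (trans (Bf-expand _ _) (+-congʳ (x-0≈x (τ-zeroˡ _)))) ⟩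
      (τ Y (F₁ s) - Q) + (τ Y (F₁ s) - Q)
        ≈⟨ rearrange (τ Y (F₁ s)) (τ (F₁ t) (F₁ s)) P Q ⟩
      (((τ Y (F₁ s) + τ Y (F₁ s)) - τ (F₁ t) (F₁ s)) + (P - Q)) + ((τ (F₁ t) (F₁ s) - P) - Q)
        ≈⟨ +-cong (+-congʳ (sym (trans (τ--ˡ _ _ _) (+-congʳ (τ-+ˡ _ _ _))))) (sym (Bf-expand (F t) (F s))) ⟩
      (τ ((Y + Y) - F₁ t) (F₁ s) + D t s) + Bf (F t) (F s) ∎
      where
      P = τ (F₀ t) (F₂ s)
      Q = τ (F₂ t) (F₀ s)
      rearrange : ∀ T S P Q → (T - Q) + (T - Q) ≈ (((T + T) - S) + (P - Q)) + ((S - P) - Q)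
      rearrange = solve 4 (λ T S P Q → (T :- Q) :+ (T :- Q) := (((T :+ T) :- S) :+ (P :- Q)) :+ ((S :- P) :- Q)) refl

    Bf-F₀Y0-twice : ∀ Y t s → Bf ⟨ F₀ t , Y , 0# ⟩ (F s) + Bf ⟨ F₀ t , Y , 0# ⟩ (F s)
                              ≈ (τ ((Y + Y) - F₁ t) (F₁ s) - D t s) + Bf (F t) (F s)
    Bf-F₀Y0-twice Y t s = begin
      Bf ⟨ F₀ t , Y , 0# ⟩ (F s) + Bf ⟨ F₀ t , Y , 0# ⟩ (F s)
        ≈⟨ +-cong (trans (Bf-expand _ _) (x-0≈x (τ-zeroˡ _))) (trans (Bf-expand _ _) (x-0≈x (τ-zeroˡ _))) ⟩
      (τ Y (F₁ s) - P) + (τ Y (F₁ s) - P)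
        ≈⟨ rearrange (τ Y (F₁ s)) (τ (F₁ t) (F₁ s)) P Q ⟩
      (((τ Y (F₁ s) + τ Y (F₁ s)) - τ (F₁ t) (F₁ s)) - (P - Q)) + ((τ (F₁ t) (F₁ s) - P) - Q)
        ≈⟨ +-cong (+-congʳ (sym (trans (τ--ˡ _ _ _) (+-congʳ (τ-+ˡ _ _ _))))) (sym (Bf-expand (F t) (F s))) ⟩
      (τ ((Y + Y) - F₁ t) (F₁ s) - D t s) + Bf (F t) (F s) ∎
      where
      P = τ (F₀ t) (F₂ s)
      Q = τ (F₂ t) (F₀ s)
      rearrange : ∀ T S P Q → (T - P) + (T - P) ≈ (((T + T) - S) - (P - Q)) + ((S - P) - Q)
      rearrange = solve 4 (λ T S P Q → (T :- P) :+ (T :- P) := (((T :+ T) :- S) :- (P :- Q)) :+ ((S :- P) :- Q)) refl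

    -- Adding and subtracting the two conditions separates them: the sum tests
    -- (Y + Y) − F₁ t against all of GF(q²) = F₁(GF(q²)), the difference is D.
    ⊥n-pair⇒ : ∀ {Y t} → (n ⊥) ⟨ 0# , Y , F₂ t ⟩ → (n ⊥) ⟨ F₀ t , Y , 0# ⟩ → Y + Y ≈ F₁ t × (∀ s → D t s ≈ 0#)
    ⊥n-pair⇒ {Y} {t} ⊥n₁ ⊥n₂ = Y+Y≈F₁t , λ s → proj₂ (separate s)
      where
      separate : ∀ s → τ ((Y + Y) - F₁ t) (F₁ s) ≈ 0# × D t s ≈ 0#
      separate s = x+y≈0∧x-y≈0⇒x≈0∧y≈0
        (a+a≈b+d⇒b≈0 (Bf-0YF₂-twice Y t s) (⊥n⇒ ⊥n₁ s) (n-isotropic t s))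
        (a+a≈b+d⇒b≈0 (Bf-F₀Y0-twice Y t s) (⊥n⇒ ⊥n₂ s) (n-isotropic t s))
      K≈0 : (Y + Y) - F₁ t ≈ 0#
      K≈0 = τ-nondegenerate λ r →
        let s , F₁s≈r = F₁-surjective r in trans (τ-cong refl (sym F₁s≈r)) (proj₁ (separate s))
      Y+Y≈F₁t : Y + Y ≈ F₁ t
      Y+Y≈F₁t = x-y≈0⇒x≈y _ _ K≈0

    ⊥n-pair⇐ : ∀ {Y t} → Y + Y ≈ F₁ t → (∀ s → D t s ≈ 0#) → (n ⊥) ⟨ 0# , Y , F₂ t ⟩ × (n ⊥) ⟨ F₀ t , Y , 0# ⟩
    ⊥n-pair⇐ {Y} {t} Y+Y≈F₁t D≈0 =
      ⇒⊥n (λ s → a+a≈b+c+d⇒a≈0 (Bf-0YF₂-twice Y t s) (τK≈0 s) (D≈0 s) (n-isotropic t s)) ,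
      ⇒⊥n (λ s → a+a≈b+c+d⇒a≈0 (Bf-F₀Y0-twice Y t s) (τK≈0 s) (trans (-‿cong (D≈0 s)) -0#≈0#) (n-isotropic t s))
      where
      τK≈0 : ∀ s → τ ((Y + Y) - F₁ t) (F₁ s) ≈ 0#
      τK≈0 s = trans (τ-cong (x≈y⇒x-y≈0 Y+Y≈F₁t) refl) (τ-zeroˡ _)

    half : Carrier
    half = proj₁ (∃-inverse (1# + 1#) 2≉0)

    2*half≈1 : (1# + 1#) * half ≈ 1#
    2*half≈1 = proj₂ (∃-inverse (1# + 1#) 2≉0)

    half*x+half*x≈x : ∀ x → half * x + half * x ≈ x
    half*x+half*x≈x x = begin
      half * x + half * x    ≈⟨ sym (distribʳ x half half) ⟩
      (half + half) * x      ≈⟨ *-congʳ (trans (+-cong (sym (*-identityˡ half)) (sym (*-identityˡ half))) (sym (distribʳ half 1# 1#))) ⟩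
      ((1# + 1#) * half) * x ≈⟨ *-congʳ 2*half≈1 ⟩
      1# * x                 ≈⟨ *-identityˡ x ⟩
      x                      ∎

    y+y≈x⇒y≈half*x : ∀ {y x} → y + y ≈ x → y ≈ half * x
    y+y≈x⇒y≈half*x {y} {x} y+y≈x = begin
      y                      ≈⟨ sym (*-identityˡ y) ⟩
      1# * y                 ≈⟨ *-congʳ (sym 2*half≈1) ⟩
      ((1# + 1#) * half) * y ≈⟨ trans (*-congʳ (*-comm _ _)) (*-assoc _ _ _) ⟩
      half * ((1# + 1#) * y) ≈⟨ *-congˡ (trans (distribʳ y 1# 1#) (+-cong (*-identityˡ y) (*-identityˡ y))) ⟩
      half * (y + y)         ≈⟨ *-congˡ y+y≈x ⟩
      half * x               ∎

    half*x≈0⇒x≈0 : ∀ {x} → half * x ≈ 0# → x ≈ 0#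
    half*x≈0⇒x≈0 {x} half*x≈0 = begin
      x                         ≈⟨ sym (half*x+half*x≈x x) ⟩
      half * x + half * x       ≈⟨ trans (+-cong half*x≈0 half*x≈0) (+-identityʳ 0#) ⟩
      0#                        ∎

    G : Carrier → V
    G t = ⟨ F₀ t , half * F₁ t , F₂ t ⟩

    G-cong : ∀ {t t'} → t ≈ t' → G t ≈ᵥ G t'
    G-cong t≈t' = lin-cong f₀ g₀ t≈t' , *-congˡ (lin-cong f₁ g₁ t≈t') , lin-cong f₂ g₂ t≈t'

    G-linear : ∀ {a b} x y → InGFq a → InGFq b → ((a ·ᵥ G x) +ᵥ (b ·ᵥ G y)) ≈ᵥ G (a * x + b * y)
    G-linear {a} {b} x y a∈K b∈K =
        sym (lin-linear f₀ g₀ x y a∈K b∈K)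
      , trans (pull-half a b half (F₁ x) (F₁ y)) (*-congˡ (sym (lin-linear f₁ g₁ x y a∈K b∈K)))
      , sym (lin-linear f₂ g₂ x y a∈K b∈K)
      where
      pull-half : ∀ a b h u v → a * (h * u) + b * (h * v) ≈ h * (a * u + b * v)
      pull-half = solve 5 (λ a b h u v → a :* (h :* u) :+ b :* (h :* v) := h :* (a :* u :+ b :* v)) refl

    Σ₁₂₃⇒G : ∀ {v} → Σ₁₂₃ v → ∃ λ t → v ≈ᵥ G t × (∀ s → D t s ≈ 0#)
    Σ₁₂₃⇒G {v} v∈Σ₁₂₃ =
      let t , x≈F₀t , z≈F₂t , ⊥n₁ , ⊥n₂ = Σ₁₂₃⇒⊥n-pair v∈Σ₁₂₃
          Y+Y≈F₁t , D≈0 = ⊥n-pair⇒ ⊥n₁ ⊥n₂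
      in t , (x≈F₀t , y+y≈x⇒y≈half*x Y+Y≈F₁t , z≈F₂t) , D≈0

    G⇒Σ₁₂₃ : ∀ {v t} → v ≈ᵥ G t → (∀ s → D t s ≈ 0#) → Σ₁₂₃ v
    G⇒Σ₁₂₃ {v} {t} (x≈F₀t , y≈halfF₁t , z≈F₂t) D≈0 =
      let ⊥n₁ , ⊥n₂ = ⊥n-pair⇐ Y+Y≈F₁t D≈0 in ⊥n-pair⇒Σ₁₂₃ x≈F₀t z≈F₂t ⊥n₁ ⊥n₂
      where
      Y+Y≈F₁t : vy v + vy v ≈ F₁ t
      Y+Y≈F₁t = trans (+-cong y≈halfF₁t y≈halfF₁t) (half*x+half*x≈x (F₁ t))

    γ∉K⇒Σ₁₂₃≈0 : ¬ InGFq γ → ∀ v → Σ₁₂₃ v → v ≈ᵥ 0ᵥ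
    γ∉K⇒Σ₁₂₃≈0 γ∉K v v∈Σ₁₂₃ =
      let t , v≈Gt , D≈0 = Σ₁₂₃⇒G v∈Σ₁₂₃
          t≈0 = t̄s-ts̄≈0⇒t≈0 (λ s → [γ-γ̄]x≈0⇒x≈0 (trans (sym (D≈[γ-γ̄]* t s)) (D≈0 s)))
      in ≈ᵥ-trans v≈Gt (≈ᵥ-trans (G-cong t≈0) (lin-0 f₀ g₀ , trans (*-congˡ (lin-0 f₁ g₁)) (zeroʳ half) , lin-0 f₂ g₂))
      where
      [γ-γ̄]x≈0⇒x≈0 : ∀ {x} → (γ - conj γ) * x ≈ 0# → x ≈ 0#
      [γ-γ̄]x≈0⇒x≈0 [γ-γ̄]x≈0 with x*y≈0⇒x≈0⊎y≈0 [γ-γ̄]x≈0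
      ... | inj₂ x≈0 = x≈0
      ... | inj₁ γ-γ̄≈0 = ⊥-elim (γ∉K (sym (x-y≈0⇒x≈y _ _ γ-γ̄≈0)))

    perspective⇒γ∈K : InPerspective l m n → InGFq γ
    perspective⇒γ∈K dim2 with conj γ ≟ γ
    ... | yes γ∈K = γ∈K
    ... | no γ∉K = ⊥-elim (Dim2⇒nonzero dim2 (γ∉K⇒Σ₁₂₃≈0 γ∉K))

    -- With γ fixed, Σ₁₂₃ is the image of the injective GF(q)-linear map G,
    -- whose basis is the G-image of the F₁-preimages of 1 and ω.
    γ∈K⇒perspective : InGFq γ → InPerspective l m n
    γ∈K⇒perspective γ∈K = G s₁ , G s₂ , independent′ , (λ a b a∈K b∈K → G⇒Σ₁₂₃ (G-linear s₁ s₂ a∈K b∈K) (D≈0 _)) , spanned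
      where
      D≈0 : ∀ t s → D t s ≈ 0#
      D≈0 t s = trans (D≈[γ-γ̄]* t s) (trans (*-congʳ (x≈y⇒x-y≈0 (sym γ∈K))) (zeroˡ _))
      s₁ = proj₁ (F₁-surjective 1#)
      s₂ = proj₁ (F₁-surjective ω)
      F₁-coordinates : ∀ {a b} → InGFq a → InGFq b → F₁ (a * s₁ + b * s₂) ≈ a + b * ω
      F₁-coordinates {a} {b} a∈K b∈K = trans (lin-linear f₁ g₁ s₁ s₂ a∈K b∈K)
        (+-cong (trans (*-congˡ (proj₂ (F₁-surjective 1#))) (*-identityʳ a)) (*-congˡ (proj₂ (F₁-surjective ω))))
      independent′ : ∀ a b → InGFq a → InGFq b → ((a ·ᵥ G s₁) +ᵥ (b ·ᵥ G s₂)) ≈ᵥ 0ᵥ → a ≈ 0# × b ≈ 0#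
      independent′ a b a∈K b∈K (_ , y≈0 , _) = independent a∈K b∈K (begin
        a + b * ω                   ≈⟨ sym (F₁-coordinates a∈K b∈K) ⟩
        F₁ (a * s₁ + b * s₂)        ≈⟨ halfF≈0 ⟩
        0#                          ∎)
        where
        halfF≈0 : F₁ (a * s₁ + b * s₂) ≈ 0#
        halfF≈0 = half*x≈0⇒x≈0 (trans (sym (proj₁ (proj₂ (G-linear s₁ s₂ a∈K b∈K)))) y≈0)
      spanned : ∀ v → Σ₁₂₃ v → ∃₂ λ a b → InGFq a × InGFq b × v ≈ᵥ ((a ·ᵥ G s₁) +ᵥ (b ·ᵥ G s₂))
      spanned v v∈Σ₁₂₃ =
        let t , v≈Gt , _ = Σ₁₂₃⇒G v∈Σ₁₂₃
            a , b , a∈K , b∈K , F₁t≈a+bω = decompose (F₁ t)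
            t≈as₁+bs₂ = F₁-cancel (trans F₁t≈a+bω (sym (F₁-coordinates a∈K b∈K)))
        in a , b , a∈K , b∈K , ≈ᵥ-trans v≈Gt (≈ᵥ-trans (G-cong t≈as₁+bs₂) (≈ᵥ-sym (G-linear s₁ s₂ a∈K b∈K)))

proposition3p1 : {c ℓ : Level} (R : CommutativeRing c ℓ) (q : ℕ) →
    OddPrimePower q →
    Geometry.IsField R →
    Geometry.HasSize R (q *ℕ q) →
    (f₀ g₀ f₁ g₁ f₂ g₂ : CommutativeRing.Carrier R) →
    let open CommutativeRing R
        open Geometry.WithQ R q
        l = L I O O
        m = L O O I
        n = L (lin f₀ g₀) (lin f₁ g₁) (lin f₂ g₂)
    in IsLine n →
       SpanAll l m n →
       (InPerspective l m n ⇔ InGFq (conj f₀ * f₂ + g₀ * conj g₂))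
proposition3p1 R q q-odd isField size f₀ g₀ f₁ g₁ f₂ g₂ n-line span =
  mk⇔ (perspective⇒γ∈K n-line span) (γ∈K⇒perspective n-line span)
  where open Configuration R q q-odd isField size f₀ g₀ f₁ g₁ f₂ g₂
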